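{- For any mixed graph $D$, $T^{(2)}_D(0,2)$ equals the number of complete orientations of $D$ that are totally cyclic.
   Context: Digraphs $D=(V,A)$ are finite, loops and multiple arcs allowed. The $B$-polynomial $B_D(q,y,z)$ is the unique polynomial such that for every positive integer $q$, $B_D(q,y,z)=\sum_{f:V\to\{1,\dots,q\}} y^{\#\{(u,v)\in A: f(v)>f(u)\}} z^{\#\{(u,v)\in A: f(v)<f(u)\}}$. A mixed graph is a digraph $D=(V,A)$ with a partition $E(D)$ of $A$ into singletons (oriented edges) and doubletons $\{(u,v),(v,u)\}$ of opposite arcs (unoriented edges). A complete orientation keeps exactly one arc of each unoriented edge; $\mathrm{ori}(D)$ is the set of complete orientations. $\mathrm{c}(D)$ is the number of connected components of the underlying graph. $T^{(2)}_D(x,y)=\frac{y^{|E(D)|}}{2^{|E(D)|}(y-1)^{|V|}(x-1)^{\mathrm{c}(D)}}\sum_{\vec D\in\mathrm{ori}(D)}B_{\vec D}\big((x-1)(y-1),\tfrac{2-y}{y},1\big)$, which is a polynomial in $x,y$. A digraph is totally cyclic if every arc lies on a directed cycle. -}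

module Defs where

open import Data.Nat.Base as ℕ using (ℕ; zero; suc)
open import Data.Fin.Base using (Fin; toℕ)
open import Data.Fin.Properties using () renaming (_≟_ to _≟ᶠ_)
open import Data.Integer.Base using (+_)
open import Data.Rational.Base using (ℚ; 0ℚ; 1ℚ; _+_; _*_; _/_)
open import Data.List.Base using (List; []; _∷_; map; concatMap; length; filterᵇ; foldr)
open import Data.List.Membership.Propositional using (_∈_)
open import Data.List.Relation.Unary.All using (All; []; _∷_)
open import Data.List.Relation.Unary.Unique.Propositional using (Unique)
open import Data.Vec.Base using (Vec; []; _∷_; lookup)
open import Data.List.Base using () renaming (allFin to allFinL)
open import Data.Product.Base using (Σ; _×_; _,_; proj₁; proj₂)
open import Data.Sum.Base using (_⊎_)
open import Data.Unit.Base using (⊤; tt)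
open import Data.Bool.Base using (Bool; true; false)
open import Relation.Binary.PropositionalEquality using (_≡_)
open import Function.Bundles using (_⇔_)

ℕtoℚ : ℕ → ℚ
ℕtoℚ k = + k / 1

two : ℚ
two = ℕtoℚ 2

infixr 8 _^ℚ_
_^ℚ_ : ℚ → ℕ → ℚ
x ^ℚ zero  = 1ℚ
x ^ℚ suc k = x * (x ^ℚ k)

sumℚ : List ℚ → ℚ
sumℚ = foldr _+_ 0ℚ

-- Univariate polynomials over ℚ as coefficient lists (constant term first).
Poly : Set
Poly = List ℚ

eval : Poly → ℚ → ℚ
eval p x = foldr (λ c acc → c + x * acc) 0ℚ p

-- Digraphs on vertex set Fin n: a list of arcs (u , v) (loops and
-- repeated arcs allowed).

Arc : ℕ → Set
Arc n = Fin n × Fin n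

-- all maps f : Fin n → Fin q, as vectors (f u = lookup f u);
-- Fin q = {0,…,q-1} stands for {1,…,q} (only the order matters).
allMaps : (n q : ℕ) → List (Vec (Fin q) n)
allMaps zero    q = [] ∷ []
allMaps (suc n) q = concatMap (λ f → map (λ i → i ∷ f) (allFinL q)) (allMaps n q)

ascents : ∀ {n q} → List (Arc n) → Vec (Fin q) n → ℕ
ascents A f = length (filterᵇ (λ a → toℕ (lookup f (proj₁ a)) ℕ.<ᵇ toℕ (lookup f (proj₂ a))) A)

descents : ∀ {n q} → List (Arc n) → Vec (Fin q) n → ℕ
descents A f = length (filterᵇ (λ a → toℕ (lookup f (proj₂ a)) ℕ.<ᵇ toℕ (lookup f (proj₁ a))) A)

-- B_D(q,y,z) evaluated at a positive integer q, as the defining sum.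
Bsum : ∀ {n} → List (Arc n) → (q : ℕ) → ℚ → ℚ → ℚ
Bsum {n} A q y z = sumℚ (map (λ f → (y ^ℚ ascents A f) * (z ^ℚ descents A f)) (allMaps n q))

data Walk {n : ℕ} : Fin n → List (Arc n) → Fin n → Set where
  nil  : ∀ {x} → Walk x [] x
  cons : ∀ {x y z w} → Walk y w z → Walk x ((x , y) ∷ w) z

-- arc (u , v) lies on a directed cycle of the digraph A: there is a
-- closed walk (u,v) , w  using arcs of A whose tails (visited vertices)
-- are pairwise distinct.
OnDirectedCycle : ∀ {n} → List (Arc n) → Arc n → Set
OnDirectedCycle {n} A (u , v) =
  Σ (List (Arc n)) λ w → All (_∈ A) w × Walk v w u × Unique (u ∷ map proj₁ w)

TotallyCyclic : ∀ {n} → List (Arc n) → Set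
TotallyCyclic A = All (OnDirectedCycle A) A

data Edge (n : ℕ) : Set where
  oriented   : Fin n → Fin n → Edge n   -- the singleton {(u,v)}
  unoriented : Fin n → Fin n → Edge n   -- the doubleton {(u,v),(v,u)}

Choice : ∀ {n} → Edge n → Set
Choice (oriented _ _)   = ⊤
Choice (unoriented _ _) = Bool

allChoices : ∀ {n} (e : Edge n) → List (Choice e)
allChoices (oriented _ _)   = tt ∷ []
allChoices (unoriented _ _) = true ∷ false ∷ []

chosenArc : ∀ {n} (e : Edge n) → Choice e → Arc n
chosenArc (oriented u v)   _     = (u , v)
chosenArc (unoriented u v) true  = (u , v)
chosenArc (unoriented u v) false = (v , u)

Orientation : ∀ {n} → List (Edge n) → Set
Orientation es = All Choice es

allOrientations : ∀ {n} (es : List (Edge n)) → List (Orientation es)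
allOrientations []       = [] ∷ []
allOrientations (e ∷ es) =
  concatMap (λ c → map (λ o → c ∷ o) (allOrientations es)) (allChoices e)

orientedArcs : ∀ {n} {es : List (Edge n)} → Orientation es → List (Arc n)
orientedArcs {es = []}     []       = []
orientedArcs {es = e ∷ es} (c ∷ o) = chosenArc e c ∷ orientedArcs o

ends : ∀ {n} → Edge n → Arc n
ends (oriented u v)   = (u , v)
ends (unoriented u v) = (u , v)

Adjacent : ∀ {n} → List (Edge n) → Fin n → Fin n → Set
Adjacent es u w = Σ _ λ e → e ∈ es × (ends e ≡ (u , w) ⊎ ends e ≡ (w , u))

data Connected {n : ℕ} (es : List (Edge n)) : Fin n → Fin n → Set where
  here : ∀ {u} → Connected es u u
  step : ∀ {u w v} → Adjacent es u w → Connected es w v → Connected es u v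

-- c(D) = k : the components are in bijection with Fin k, i.e. there is
-- a surjective labelling of vertices by Fin k whose fibres are exactly
-- the connectivity classes.
NumComponents : ∀ {n} → List (Edge n) → ℕ → Set
NumComponents {n} es k =
  Σ (Fin n → Fin k) λ comp →
    (∀ (i : Fin k) → Σ (Fin n) λ u → comp u ≡ i) ×
    (∀ u v → (comp u ≡ comp v) ⇔ Connected es u v)

-- At y = 2 the weight (2 − y)/y of the B-polynomial vanishes, so for each orientation B(q, 0, 1)
-- counts the maps f : V → [q] with f(v) ≤ f(u) on every arc (u, v), and T⁽²⁾_D(0, 2) is the sum of
-- these counting polynomials at q = (x − 1)(y − 1) = −1.  On a totally cyclic orientation such f are
-- exactly the maps constant on components, so the count is q^c(D), contributing (−1)^c(D).
-- Otherwise the value at −1 is 0: counting maps supported in a vertex set W and splitting off the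
-- support of f gives Ω_W(q + 1) = Σ Ω_T(q) over the predecessor-closed T ⊆ W, hence Σ_T χ_T = [W = ∅]
-- for χ_W = Ω_W(−1).  Separating the T inside the initial strong components of W, induction on |W|
-- shows χ_W = 0 whenever some arc into W lies on no directed cycle.

module Submission where

open import Defs
open import Data.Nat.Base as ℕ using (ℕ; zero; suc; _≤_; _<ᵇ_)
import Data.Nat.Properties as ℕ
import Data.Nat.Coprimality as Coprime
import Data.Integer.Base as ℤ
import Data.Integer.Properties as ℤ
open import Data.Rational.Base
  using (ℚ; 0ℚ; 1ℚ; _+_; _*_; _-_; -_; _÷_; mkℚ; _/_; NonZero; ≢-nonZero; 1/_)
open import Data.Rational.Properties
  using ( normalize-coprime; mkℚ-injective; +-identityˡ; +-identityʳ; +-assoc; +-comm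
        ; *-comm; *-assoc; *-zeroˡ; *-zeroʳ; *-identityˡ; *-identityʳ; *-inverseˡ; *-inverseʳ
        ; +-0-group)
  renaming (_≟_ to _≟ℚ_)
open import Algebra.Properties.Group +-0-group using (x∙y⁻¹≈ε⇒x≈y)
open import Data.Rational.Solver
open +-*-Solver
open import Data.Bool.Base using (Bool; true; false; _∧_; _∨_; not; if_then_else_)
open import Data.Bool.Properties using (∧-identityʳ; ∧-zeroʳ) renaming (_≟_ to _≟ᵇ_)
open import Data.List.Base as List
  using (List; []; _∷_; map; concatMap; _++_; foldr; length; filter; filterᵇ; allFin)
open import Data.List.Properties using (length-map; map-tabulate)
open import Data.List.Membership.Propositional using (_∈_; find; lose)
open import Data.List.Membership.Propositional.Properties using (∈-map⁻; ∈-++⁻; ∈-allFin)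
open import Data.List.Relation.Unary.Any using (Any; here; there; any?)
open import Data.List.Relation.Unary.All using (All; []; _∷_)
import Data.List.Relation.Unary.All as All
open import Data.List.Relation.Unary.All.Properties using (¬Any⇒All¬)
open import Data.List.Relation.Unary.AllPairs using ([]; _∷_)
open import Data.List.Relation.Unary.Unique.Propositional using (Unique)
open import Data.Vec.Base as Vec using (Vec; []; _∷_; lookup; tabulate)
open import Data.Vec.Properties
  using (∷-injectiveʳ; lookup∘tabulate; tabulate∘lookup; tabulate-cong; lookup-map; lookup-replicate; ≡-dec)
open import Data.Fin.Base as Fin using (Fin; toℕ)
import Data.Fin.Properties as Fin
open import Data.Fin.Subset using (Subset; ⊤)
open import Data.Product.Base using (Σ; _×_; _,_; proj₁; proj₂)
open import Data.Sum.Base using (_⊎_; inj₁; inj₂)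
open import Data.Empty using (⊥-elim)
open import Function.Base using (_∘_)
open import Function.Bundles using (_⇔_; Equivalence; mk⇔)
open import Relation.Binary.Construct.Closure.ReflexiveTransitive using (Star; ε; _◅_; _◅◅_)
open import Relation.Binary.Definitions using (DecidableEquality)
open import Relation.Binary.PropositionalEquality
open import Relation.Nullary using (¬_; Dec; does; yes; no)
open import Relation.Nullary.Decidable
  using (isYes; dec-false; does-⇔; decidable-stable; ¬¬-excluded-middle)

private variable
  n : ℕ
  X Y : Set

ℕtoℚ-mkℚ : ∀ k → ℕtoℚ k ≡ mkℚ (ℤ.+ k) 0 (Coprime.sym (Coprime.1-coprimeTo k))
ℕtoℚ-mkℚ k = normalize-coprime (Coprime.sym (Coprime.1-coprimeTo k))

ℕtoℚ-suc : ∀ k → ℕtoℚ (suc k) ≡ ℕtoℚ k + 1ℚ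
ℕtoℚ-suc k = sym (trans (cong (_+ 1ℚ) (ℕtoℚ-mkℚ k))
  (cong (_/ 1) (trans (cong (ℤ._+ ℤ.+ 1) (ℤ.*-identityʳ (ℤ.+ k))) (cong ℤ.+_ (ℕ.+-comm k 1)))))

ℕtoℚ-injective : ∀ {a b} → ℕtoℚ a ≡ ℕtoℚ b → a ≡ b
ℕtoℚ-injective {a} {b} eq =
  ℤ.+-injective (proj₁ (mkℚ-injective (trans (sym (ℕtoℚ-mkℚ a)) (trans eq (ℕtoℚ-mkℚ b)))))

ℕtoℚ-suc-nonZero : ∀ j → NonZero (ℕtoℚ (suc j))
ℕtoℚ-suc-nonZero j = ≢-nonZero (λ eq → ℕ.1+n≢0 (ℕtoℚ-injective {suc j} {0} eq))

recip-suc : ℕ → ℚ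
recip-suc j = (1/ ℕtoℚ (suc j)) {{ℕtoℚ-suc-nonZero j}}

ℕtoℚ-suc-*-recip-suc : ∀ j → ℕtoℚ (suc j) * recip-suc j ≡ 1ℚ
ℕtoℚ-suc-*-recip-suc j = *-inverseʳ (ℕtoℚ (suc j)) {{ℕtoℚ-suc-nonZero j}}

∑ : List X → (X → ℚ) → ℚ
∑ xs f = sumℚ (map f xs)

∑-++ : ∀ (xs ys : List X) f → ∑ (xs ++ ys) f ≡ ∑ xs f + ∑ ys f
∑-++ []       ys f = sym (+-identityˡ _)
∑-++ (x ∷ xs) ys f = trans (cong (f x +_) (∑-++ xs ys f)) (sym (+-assoc (f x) _ _))

∑-cong : ∀ (xs : List X) {f g} → (∀ x → f x ≡ g x) → ∑ xs f ≡ ∑ xs g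
∑-cong []       eq = refl
∑-cong (x ∷ xs) eq = cong₂ _+_ (eq x) (∑-cong xs eq)

∑-cong-∈ : ∀ (xs : List X) {f g} → (∀ x → x ∈ xs → f x ≡ g x) → ∑ xs f ≡ ∑ xs g
∑-cong-∈ []       eq = refl
∑-cong-∈ (x ∷ xs) eq = cong₂ _+_ (eq x (here refl)) (∑-cong-∈ xs (λ y y∈ → eq y (there y∈)))

∑-zero : ∀ (xs : List X) → ∑ xs (λ _ → 0ℚ) ≡ 0ℚ
∑-zero []       = refl
∑-zero (x ∷ xs) = cong (0ℚ +_) (∑-zero xs)

∑-zero-∈ : ∀ (xs : List X) f → (∀ x → x ∈ xs → f x ≡ 0ℚ) → ∑ xs f ≡ 0ℚ
∑-zero-∈ xs f eq = trans (∑-cong-∈ xs eq) (∑-zero xs)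

∑-+ : ∀ (xs : List X) f g → ∑ xs (λ x → f x + g x) ≡ ∑ xs f + ∑ xs g
∑-+ []       f g = refl
∑-+ (x ∷ xs) f g = trans (cong ((f x + g x) +_) (∑-+ xs f g))
  (solve 4 (λ a b c d → (a :+ b) :+ (c :+ d) := (a :+ c) :+ (b :+ d)) refl (f x) (g x) (∑ xs f) (∑ xs g))

∑-*ˡ : ∀ (xs : List X) c f → ∑ xs (λ x → c * f x) ≡ c * ∑ xs f
∑-*ˡ []       c f = sym (*-zeroʳ c)
∑-*ˡ (x ∷ xs) c f = trans (cong (c * f x +_) (∑-*ˡ xs c f))
  (solve 3 (λ c a b → c :* a :+ c :* b := c :* (a :+ b)) refl c (f x) (∑ xs f))

∑-*ʳ : ∀ (xs : List X) c f → ∑ xs (λ x → f x * c) ≡ ∑ xs f * c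
∑-*ʳ xs c f = trans (∑-cong xs (λ x → *-comm (f x) c)) (trans (∑-*ˡ xs c f) (*-comm c (∑ xs f)))

∑-map : (g : X → Y) (xs : List X) (f : Y → ℚ) → ∑ (map g xs) f ≡ ∑ xs (λ x → f (g x))
∑-map g []       f = refl
∑-map g (x ∷ xs) f = cong (f (g x) +_) (∑-map g xs f)

∑-concatMap : (g : X → List Y) (xs : List X) (f : Y → ℚ) →
  ∑ (concatMap g xs) f ≡ ∑ xs (λ x → ∑ (g x) f)
∑-concatMap g []       f = refl
∑-concatMap g (x ∷ xs) f = trans (∑-++ (g x) (concatMap g xs) f) (cong (∑ (g x) f +_) (∑-concatMap g xs f))

∑-swap : (xs : List X) (ys : List Y) (F : X → Y → ℚ) →
  ∑ xs (λ x → ∑ ys (F x)) ≡ ∑ ys (λ y → ∑ xs (λ x → F x y))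
∑-swap []       ys F = sym (∑-zero ys)
∑-swap (x ∷ xs) ys F = trans (cong (∑ ys (F x) +_) (∑-swap xs ys F))
  (sym (∑-+ ys (F x) (λ y → ∑ xs (λ x' → F x' y))))

𝟙 : Bool → ℚ
𝟙 true  = 1ℚ
𝟙 false = 0ℚ

𝟙-∧ : ∀ a b → 𝟙 (a ∧ b) ≡ 𝟙 a * 𝟙 b
𝟙-∧ true  b = sym (*-identityˡ (𝟙 b))
𝟙-∧ false b = sym (*-zeroˡ (𝟙 b))

𝟙-split : ∀ x y c → 𝟙 x * c ≡ 𝟙 (x ∧ y) * c + 𝟙 (x ∧ not y) * c
𝟙-split false y     c = solve 1 (λ c → con 0ℚ :* c := con 0ℚ :* c :+ con 0ℚ :* c) refl c
𝟙-split true  true  c = solve 1 (λ c → con 1ℚ :* c := con 1ℚ :* c :+ con 0ℚ :* c) refl c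
𝟙-split true  false c = solve 1 (λ c → con 1ℚ :* c := con 0ℚ :* c :+ con 1ℚ :* c) refl c

allᵇ : (X → Bool) → List X → Bool
allᵇ p = foldr (λ x b → p x ∧ b) true

allᵇ-∧ : (p r : X → Bool) (xs : List X) → allᵇ (λ x → p x ∧ r x) xs ≡ allᵇ p xs ∧ allᵇ r xs
allᵇ-∧ p r []       = refl
allᵇ-∧ p r (x ∷ xs) =
  trans (cong ((p x ∧ r x) ∧_) (allᵇ-∧ p r xs)) (interchange (p x) (r x) (allᵇ p xs) (allᵇ r xs))
  where
  interchange : ∀ a b c d → (a ∧ b) ∧ (c ∧ d) ≡ (a ∧ c) ∧ (b ∧ d)
  interchange true  b true  d = refl
  interchange true  b false d = ∧-zeroʳ b
  interchange false b c     d = refl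

allᵇ-cong-∈ : {p r : X → Bool} (xs : List X) → (∀ x → x ∈ xs → p x ≡ r x) → allᵇ p xs ≡ allᵇ r xs
allᵇ-cong-∈ []       eq = refl
allᵇ-cong-∈ (x ∷ xs) eq = cong₂ _∧_ (eq x (here refl)) (allᵇ-cong-∈ xs (λ y y∈ → eq y (there y∈)))

allᵇ-true-∈ : (p : X → Bool) (xs : List X) → allᵇ p xs ≡ true → ∀ {x} → x ∈ xs → p x ≡ true
allᵇ-true-∈ p (y ∷ xs) e (here refl) with p y
... | true = refl
allᵇ-true-∈ p (y ∷ xs) e (there x∈) with p y
... | true = allᵇ-true-∈ p xs e x∈

allᵇ-false-∈ : (p : X → Bool) (xs : List X) → allᵇ p xs ≡ false → Σ X (λ x → x ∈ xs × p x ≡ false)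
allᵇ-false-∈ p (y ∷ xs) e with p y in eq
... | false = y , here refl , eq
... | true with allᵇ-false-∈ p xs e
...   | x , x∈ , ex = x , there x∈ , ex

∧-≡-true : ∀ {a b} → a ∧ b ≡ true → a ≡ true × b ≡ true
∧-≡-true {true} {true} _ = refl , refl

allᵇ-intro : (p : X → Bool) (xs : List X) → (∀ {x} → x ∈ xs → p x ≡ true) → allᵇ p xs ≡ true
allᵇ-intro p []       h = refl
allᵇ-intro p (x ∷ xs) h rewrite h (here refl) = allᵇ-intro p xs (λ x∈ → h (there x∈))

not-<ᵇ⇒≥ : ∀ x y → not (x <ᵇ y) ≡ true → y ℕ.≤ x
not-<ᵇ⇒≥ x       zero    _ = ℕ.z≤n
not-<ᵇ⇒≥ (suc x) (suc y) e = ℕ.s≤s (not-<ᵇ⇒≥ x y e)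

not-<ᵇ-refl : ∀ x → not (x <ᵇ x) ≡ true
not-<ᵇ-refl zero    = refl
not-<ᵇ-refl (suc x) = not-<ᵇ-refl x

addP : Poly → Poly → Poly
addP []      q       = q
addP (a ∷ p) []      = a ∷ p
addP (a ∷ p) (b ∷ q) = (a + b) ∷ addP p q

scaleP : ℚ → Poly → Poly
scaleP c = map (c *_)

subP : Poly → Poly → Poly
subP p q = addP p (scaleP (- 1ℚ) q)

mulLinear : ℚ → Poly → Poly
mulLinear a p = addP (0ℚ ∷ p) (scaleP (- a) p)

quotLinear : ℚ → Poly → Poly
quotLinear a []      = []
quotLinear a (c ∷ p) = addP p (scaleP a (quotLinear a p))

eval-addP : ∀ p q x → eval (addP p q) x ≡ eval p x + eval q x
eval-addP []      q       x = sym (+-identityˡ _)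
eval-addP (a ∷ p) []      x = sym (+-identityʳ _)
eval-addP (a ∷ p) (b ∷ q) x = trans (cong (λ t → (a + b) + x * t) (eval-addP p q x))
  (solve 5 (λ a b x u v → (a :+ b) :+ x :* (u :+ v) := (a :+ x :* u) :+ (b :+ x :* v))
         refl a b x (eval p x) (eval q x))

eval-scaleP : ∀ c p x → eval (scaleP c p) x ≡ c * eval p x
eval-scaleP c []      x = sym (*-zeroʳ c)
eval-scaleP c (a ∷ p) x = trans (cong (λ t → c * a + x * t) (eval-scaleP c p x))
  (solve 4 (λ c a x u → c :* a :+ x :* (c :* u) := c :* (a :+ x :* u)) refl c a x (eval p x))

eval-subP : ∀ p q x → eval (subP p q) x ≡ eval p x - eval q x
eval-subP p q x = trans (eval-addP p (scaleP (- 1ℚ) q) x)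
  (trans (cong (eval p x +_) (eval-scaleP (- 1ℚ) q x))
  (solve 2 (λ u v → u :+ (:- con 1ℚ) :* v := u :- v) refl (eval p x) (eval q x)))

eval-mulLinear : ∀ a p x → eval (mulLinear a p) x ≡ eval p x * (x - a)
eval-mulLinear a p x = trans (eval-addP (0ℚ ∷ p) (scaleP (- a) p) x)
  (trans (cong (0ℚ + x * eval p x +_) (eval-scaleP (- a) p x))
  (solve 3 (λ a x u → con 0ℚ :+ x :* u :+ (:- a) :* u := u :* (x :- a)) refl a x (eval p x)))

powP : ℕ → Poly
powP zero    = 1ℚ ∷ []
powP (suc c) = mulLinear 0ℚ (powP c)

eval-powP : ∀ c x → eval (powP c) x ≡ x ^ℚ c
eval-powP zero    x = solve 1 (λ x → con 1ℚ :+ x :* con 0ℚ := con 1ℚ) refl x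
eval-powP (suc c) x = trans (eval-mulLinear 0ℚ (powP c) x) (trans (cong (_* (x - 0ℚ)) (eval-powP c x))
  (solve 2 (λ x p → p :* (x :- con 0ℚ) := x :* p) refl x (x ^ℚ c)))

factor-theorem : ∀ a p x → eval p x ≡ eval p a + (x - a) * eval (quotLinear a p) x
factor-theorem a []      x = solve 2 (λ x a → con 0ℚ := con 0ℚ :+ (x :- a) :* con 0ℚ) refl x a
factor-theorem a (c ∷ p) x = begin
  c + x * eval p x
    ≡⟨ cong (λ t → c + x * t) IH ⟩
  c + x * (eval p a + (x - a) * d)
    ≡⟨ solve 5 (λ c x a pa d → c :+ x :* (pa :+ (x :- a) :* d)
                   := (c :+ a :* pa) :+ (x :- a) :* ((pa :+ (x :- a) :* d) :+ a :* d))
               refl c x a (eval p a) d ⟩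
  (c + a * eval p a) + (x - a) * ((eval p a + (x - a) * d) + a * d)
    ≡⟨ cong (λ t → (c + a * eval p a) + (x - a) * (t + a * d)) (sym IH) ⟩
  (c + a * eval p a) + (x - a) * (eval p x + a * d)
    ≡⟨ cong (λ t → (c + a * eval p a) + (x - a) * t) (sym (trans
         (eval-addP p (scaleP a (quotLinear a p)) x) (cong (eval p x +_) (eval-scaleP a (quotLinear a p) x)))) ⟩
  (c + a * eval p a) + (x - a) * eval (quotLinear a (c ∷ p)) x ∎
  where
  open ≡-Reasoning
  d : ℚ
  d = eval (quotLinear a p) x
  IH : eval p x ≡ eval p a + (x - a) * d
  IH = factor-theorem a p x

length-addP : ∀ p q → length (addP p q) ≡ length p ℕ.⊔ length q
length-addP []      q       = refl
length-addP (a ∷ p) []      = refl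
length-addP (a ∷ p) (b ∷ q) = cong suc (length-addP p q)

length-quotLinear   : ∀ a p → length (quotLinear a p) ℕ.≤ length p
length-quotLinear-∷ : ∀ a c p → length (quotLinear a (c ∷ p)) ℕ.≤ length p

length-quotLinear a []      = ℕ.z≤n
length-quotLinear a (c ∷ p) = ℕ.m≤n⇒m≤1+n (length-quotLinear-∷ a c p)

length-quotLinear-∷ a c p
  rewrite length-addP p (scaleP a (quotLinear a p)) | length-map (a *_) (quotLinear a p) =
  ℕ.⊔-lub ℕ.≤-refl (length-quotLinear a p)

*-cancelˡ-zero : ∀ r y → ¬ (r ≡ 0ℚ) → r * y ≡ 0ℚ → y ≡ 0ℚ
*-cancelˡ-zero r y r≢0 eq = begin
  y                ≡⟨ sym (*-identityˡ y) ⟩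
  1ℚ * y           ≡⟨ cong (_* y) (sym (*-inverseˡ r)) ⟩
  ((1/ r) * r) * y ≡⟨ *-assoc (1/ r) r y ⟩
  (1/ r) * (r * y) ≡⟨ cong ((1/ r) *_) eq ⟩
  (1/ r) * 0ℚ      ≡⟨ *-zeroʳ (1/ r) ⟩
  0ℚ               ∎
  where
  open ≡-Reasoning
  instance _ = ≢-nonZero r≢0

ℕtoℚ-sub-nonzero : ∀ {k q} → k ℕ.< q → ¬ (ℕtoℚ q - ℕtoℚ k ≡ 0ℚ)
ℕtoℚ-sub-nonzero k<q eq = ℕ.<⇒≢ k<q (sym (ℕtoℚ-injective (x∙y⁻¹≈ε⇒x≈y _ _ eq)))

-- Induction on the length bound L: dividing by (X − k) keeps vanishing on ℕ≥(k+1).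
eval-vanishes-on-ℕ≥ : ∀ p k → (∀ q → k ℕ.≤ q → eval p (ℕtoℚ q) ≡ 0ℚ) → ∀ x → eval p x ≡ 0ℚ
eval-vanishes-on-ℕ≥ p k = go (length p) p k ℕ.≤-refl
  where
  go : ∀ L p k → length p ℕ.≤ L → (∀ q → k ℕ.≤ q → eval p (ℕtoℚ q) ≡ 0ℚ) → ∀ x → eval p x ≡ 0ℚ
  go L       []      k _           _ x = refl
  go (suc L) (c ∷ p) k (ℕ.s≤s len) h x = begin
    eval (c ∷ p) x              ≡⟨ factor-theorem a (c ∷ p) x ⟩
    eval (c ∷ p) a + (x - a) * eval d x
      ≡⟨ cong₂ (λ s t → s + (x - a) * t) (h k ℕ.≤-refl)
               (go L d (suc k) (ℕ.≤-trans (length-quotLinear-∷ a c p) len) hd x) ⟩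
    0ℚ + (x - a) * 0ℚ           ≡⟨ solve 2 (λ x a → con 0ℚ :+ (x :- a) :* con 0ℚ := con 0ℚ) refl x a ⟩
    0ℚ                          ∎
    where
    open ≡-Reasoning
    a : ℚ
    a = ℕtoℚ k
    d : Poly
    d = quotLinear a (c ∷ p)
    hd : ∀ q → suc k ℕ.≤ q → eval d (ℕtoℚ q) ≡ 0ℚ
    hd q k<q = *-cancelˡ-zero (ℕtoℚ q - a) (eval d (ℕtoℚ q)) (ℕtoℚ-sub-nonzero k<q) (begin
      (ℕtoℚ q - a) * eval d (ℕtoℚ q)        ≡⟨ sym (+-identityˡ _) ⟩
      0ℚ + (ℕtoℚ q - a) * eval d (ℕtoℚ q)   ≡⟨ cong (_+ (ℕtoℚ q - a) * eval d (ℕtoℚ q)) (sym (h k ℕ.≤-refl)) ⟩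
      eval (c ∷ p) a + (ℕtoℚ q - a) * eval d (ℕtoℚ q) ≡⟨ sym (factor-theorem a (c ∷ p) (ℕtoℚ q)) ⟩
      eval (c ∷ p) (ℕtoℚ q)                 ≡⟨ h q (ℕ.≤-trans (ℕ.n≤1+n k) k<q) ⟩
      0ℚ                                    ∎)

eval-unique-from-ℕ≥ : ∀ p r k → (∀ q → k ℕ.≤ q → eval p (ℕtoℚ q) ≡ eval r (ℕtoℚ q)) →
  ∀ x → eval p x ≡ eval r x
eval-unique-from-ℕ≥ p r k h x = x∙y⁻¹≈ε⇒x≈y _ _ (trans (sym (eval-subP p r x))
  (eval-vanishes-on-ℕ≥ (subP p r) k (λ q k≤q → trans (eval-subP p r (ℕtoℚ q))
    (trans (cong (_- eval r (ℕtoℚ q)) (h q k≤q)) (solve 1 (λ u → u :- u := con 0ℚ) refl (eval r (ℕtoℚ q))))) x))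

falling : ℕ → ℚ → ℚ
falling zero    x = 1ℚ
falling (suc j) x = falling j x * (x - ℕtoℚ j)

falling-shift : ∀ j x → falling (suc j) (x + 1ℚ) ≡ (x + 1ℚ) * falling j x
falling-shift zero    x = solve 1 (λ x → con 1ℚ :* ((x :+ con 1ℚ) :- con 0ℚ) := (x :+ con 1ℚ) :* con 1ℚ) refl x
falling-shift (suc j) x =
  trans (cong₂ (λ s t → s * ((x + 1ℚ) - t)) (falling-shift j x) (ℕtoℚ-suc j))
  (solve 3 (λ x u k → ((x :+ con 1ℚ) :* u) :* ((x :+ con 1ℚ) :- (k :+ con 1ℚ)) := (x :+ con 1ℚ) :* (u :* (x :- k)))
         refl x (falling j x) (ℕtoℚ j))

falling-Δ : ∀ j x → falling (suc j) (x + 1ℚ) ≡ falling (suc j) x + ℕtoℚ (suc j) * falling j x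
falling-Δ j x = trans (falling-shift j x) (trans
  (solve 3 (λ x u k → (x :+ con 1ℚ) :* u := u :* (x :- k) :+ (k :+ con 1ℚ) :* u) refl x (falling j x) (ℕtoℚ j))
  (cong (λ t → falling (suc j) x + t * falling j x) (sym (ℕtoℚ-suc j))))

falling-suc-0 : ∀ j → falling (suc j) 0ℚ ≡ 0ℚ
falling-suc-0 zero    = refl
falling-suc-0 (suc j) = trans (cong (_* (0ℚ - ℕtoℚ (suc j))) (falling-suc-0 j)) (*-zeroˡ (0ℚ - ℕtoℚ (suc j)))

∑< : ℕ → (ℕ → ℚ) → ℚ
∑< zero    g = 0ℚ
∑< (suc N) g = ∑< N g + g N

∑<-cong : ∀ N {g h : ℕ → ℚ} → (∀ j → g j ≡ h j) → ∑< N g ≡ ∑< N h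
∑<-cong zero    eq = refl
∑<-cong (suc N) eq = cong₂ _+_ (∑<-cong N eq) (eq N)

∑<-+ : ∀ N (g h : ℕ → ℚ) → ∑< N (λ j → g j + h j) ≡ ∑< N g + ∑< N h
∑<-+ zero    g h = refl
∑<-+ (suc N) g h = trans (cong (_+ (g N + h N)) (∑<-+ N g h))
  (solve 4 (λ a b c d → (a :+ b) :+ (c :+ d) := (a :+ c) :+ (b :+ d)) refl (∑< N g) (∑< N h) (g N) (h N))

∑<-*ˡ : ∀ N c (g : ℕ → ℚ) → ∑< N (λ j → c * g j) ≡ c * ∑< N g
∑<-*ˡ zero    c g = sym (*-zeroʳ c)
∑<-*ˡ (suc N) c g = trans (cong (_+ c * g N) (∑<-*ˡ N c g))
  (solve 3 (λ c a b → c :* a :+ c :* b := c :* (a :+ b)) refl c (∑< N g) (g N))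

∑<-head : ∀ N (g : ℕ → ℚ) → (∀ j → g (suc j) ≡ 0ℚ) → ∑< (suc N) g ≡ g 0
∑<-head zero    g h = +-identityˡ (g 0)
∑<-head (suc N) g h = trans (cong₂ _+_ (∑<-head N g h) (h N)) (+-identityʳ (g 0))

∑-∑< : (xs : List X) (N : ℕ) (h : X → ℕ → ℚ) →
  ∑ xs (λ x → ∑< N (h x)) ≡ ∑< N (λ j → ∑ xs (λ x → h x j))
∑-∑< xs zero    h = ∑-zero xs
∑-∑< xs (suc N) h =
  trans (∑-+ xs (λ x → ∑< N (h x)) (λ x → h x N)) (cong (_+ ∑ xs (λ x → h x N)) (∑-∑< xs N h))

∑<-falling-Δ : ∀ N (a : ℕ → ℚ) x →
  ∑< (suc N) (λ j → a j * falling j (x + 1ℚ)) ≡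
  ∑< (suc N) (λ j → a j * falling j x) + ∑< N (λ j → ℕtoℚ (suc j) * a (suc j) * falling j x)
∑<-falling-Δ zero    a x = solve 1 (λ a → con 0ℚ :+ a :* con 1ℚ := (con 0ℚ :+ a :* con 1ℚ) :+ con 0ℚ) refl (a 0)
∑<-falling-Δ (suc N) a x =
  trans (cong₂ (λ s t → s + a (suc N) * t) (∑<-falling-Δ N a x) (falling-Δ N x))
  (solve 6 (λ S₁ S₂ a u k v → (S₁ :+ S₂) :+ a :* (u :+ k :* v) := (S₁ :+ a :* u) :+ (S₂ :+ k :* a :* v)) refl
     (∑< (suc N) (λ j → a j * falling j x)) (∑< N (λ j → ℕtoℚ (suc j) * a (suc j) * falling j x))
     (a (suc N)) (falling (suc N) x) (ℕtoℚ (suc N)) (falling N x))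

fallingP : ℕ → Poly
fallingP zero    = 1ℚ ∷ []
fallingP (suc j) = mulLinear (ℕtoℚ j) (fallingP j)

eval-fallingP : ∀ j x → eval (fallingP j) x ≡ falling j x
eval-fallingP zero    x = solve 1 (λ x → con 1ℚ :+ x :* con 0ℚ := con 1ℚ) refl x
eval-fallingP (suc j) x = trans (eval-mulLinear (ℕtoℚ j) (fallingP j) x) (cong (_* (x - ℕtoℚ j)) (eval-fallingP j x))

∑<P : ℕ → (ℕ → Poly) → Poly
∑<P zero    g = []
∑<P (suc N) g = addP (∑<P N g) (g N)

eval-∑<P : ∀ N g x → eval (∑<P N g) x ≡ ∑< N (λ j → eval (g j) x)
eval-∑<P zero    g x = refl
eval-∑<P (suc N) g x = trans (eval-addP (∑<P N g) (g N) x) (cong (_+ eval (g N) x) (eval-∑<P N g x))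

infix 4 _⊑_
infix 7 _⊆ᵇ_

data _⊑_ : Subset n → Subset n → Set where
  []   : [] ⊑ []
  skip : ∀ {b} {T W : Subset n} → T ⊑ W → (false ∷ T) ⊑ (b ∷ W)
  keep : ∀ {T W : Subset n} → T ⊑ W → (true ∷ T) ⊑ (true ∷ W)

⊑-lookup : ∀ {T W : Subset n} → T ⊑ W → ∀ v → lookup T v ≡ true → lookup W v ≡ true
⊑-lookup (skip s) Fin.zero    ()
⊑-lookup (keep s) Fin.zero    _  = refl
⊑-lookup (skip s) (Fin.suc v) eq = ⊑-lookup s v eq
⊑-lookup (keep s) (Fin.suc v) eq = ⊑-lookup s v eq

lookup-⊑ : (T W : Subset n) → (∀ v → lookup T v ≡ true → lookup W v ≡ true) → T ⊑ W
lookup-⊑ []          []      h = []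
lookup-⊑ (false ∷ T) (b ∷ W) h = skip (lookup-⊑ T W (λ v → h (Fin.suc v)))
lookup-⊑ (true ∷ T)  (b ∷ W) h with h Fin.zero refl
... | refl = keep (lookup-⊑ T W (λ v → h (Fin.suc v)))

_⊆ᵇ_ : Subset n → Subset n → Bool
[]      ⊆ᵇ []      = true
(t ∷ T) ⊆ᵇ (w ∷ W) = (not t ∨ w) ∧ (T ⊆ᵇ W)

⊆ᵇ⇒⊑ : (T W : Subset n) → T ⊆ᵇ W ≡ true → T ⊑ W
⊆ᵇ⇒⊑ []          []         _ = []
⊆ᵇ⇒⊑ (false ∷ T) (w ∷ W)    e = skip (⊆ᵇ⇒⊑ T W e)
⊆ᵇ⇒⊑ (true ∷ T)  (true ∷ W) e = keep (⊆ᵇ⇒⊑ T W e)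

⊑⇒⊆ᵇ : ∀ {T W : Subset n} → T ⊑ W → T ⊆ᵇ W ≡ true
⊑⇒⊆ᵇ []       = refl
⊑⇒⊆ᵇ (skip s) = ⊑⇒⊆ᵇ s
⊑⇒⊆ᵇ (keep s) = ⊑⇒⊆ᵇ s

size : Subset n → ℕ
size []          = 0
size (false ∷ W) = size W
size (true ∷ W)  = suc (size W)

size-≤ : (W : Subset n) → size W ℕ.≤ n
size-≤ []          = ℕ.z≤n
size-≤ (false ∷ W) = ℕ.m≤n⇒m≤1+n (size-≤ W)
size-≤ (true ∷ W)  = ℕ.s≤s (size-≤ W)

⊑-size-≤ : ∀ {T W : Subset n} → T ⊑ W → size T ℕ.≤ size W
⊑-size-≤ []                 = ℕ.z≤n
⊑-size-≤ (skip {b = false} s) = ⊑-size-≤ s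
⊑-size-≤ (skip {b = true} s)  = ℕ.m≤n⇒m≤1+n (⊑-size-≤ s)
⊑-size-≤ (keep s)           = ℕ.s≤s (⊑-size-≤ s)

⊑⇒≡⊎size-< : ∀ {T W : Subset n} → T ⊑ W → T ≡ W ⊎ size T ℕ.< size W
⊑⇒≡⊎size-< [] = inj₁ refl
⊑⇒≡⊎size-< (skip {b = false} s) with ⊑⇒≡⊎size-< s
... | inj₁ refl = inj₁ refl
... | inj₂ lt   = inj₂ lt
⊑⇒≡⊎size-< (skip {b = true} s) = inj₂ (ℕ.s≤s (⊑-size-≤ s))
⊑⇒≡⊎size-< (keep s) with ⊑⇒≡⊎size-< s
... | inj₁ refl = inj₁ refl
... | inj₂ lt   = inj₂ (ℕ.s≤s lt)

empty? : Subset n → Bool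
empty? []      = true
empty? (b ∷ W) = not b ∧ empty? W

empty?-lookup : (W : Subset n) → empty? W ≡ true → ∀ v → lookup W v ≡ false
empty?-lookup (false ∷ W) e Fin.zero    = refl
empty?-lookup (false ∷ W) e (Fin.suc v) = empty?-lookup W e v

lookup-empty? : (W : Subset n) (v : Fin n) → lookup W v ≡ true → empty? W ≡ false
lookup-empty? (true ∷ W)  Fin.zero e = refl
lookup-empty? (true ∷ W)  (Fin.suc v) e = refl
lookup-empty? (false ∷ W) (Fin.suc v) e = lookup-empty? W v e

subsetsOf : Subset n → List (Subset n)
subsetsOf []          = [] ∷ []
subsetsOf (false ∷ W) = map (false ∷_) (subsetsOf W)
subsetsOf (true ∷ W)  = map (false ∷_) (subsetsOf W) ++ map (true ∷_) (subsetsOf W)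

∈-subsetsOf⇒⊑ : (W : Subset n) {T : Subset n} → T ∈ subsetsOf W → T ⊑ W
∈-subsetsOf⇒⊑ []          (here refl) = []
∈-subsetsOf⇒⊑ (false ∷ W) T∈ with ∈-map⁻ (false ∷_) T∈
... | T' , T'∈ , refl = skip (∈-subsetsOf⇒⊑ W T'∈)
∈-subsetsOf⇒⊑ (true ∷ W)  T∈ with ∈-++⁻ (map (false ∷_) (subsetsOf W)) T∈
... | inj₁ T∈₁ with ∈-map⁻ (false ∷_) T∈₁
...   | T' , T'∈ , refl = skip (∈-subsetsOf⇒⊑ W T'∈)
∈-subsetsOf⇒⊑ (true ∷ W)  T∈ | inj₂ T∈₂ with ∈-map⁻ (true ∷_) T∈₂
...   | T' , T'∈ , refl = keep (∈-subsetsOf⇒⊑ W T'∈)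

∑-subsetsOf-proper-zero : (W : Subset n) (G : Subset n → ℚ) →
  (∀ T → T ⊑ W → ¬ T ≡ W → G T ≡ 0ℚ) → ∑ (subsetsOf W) G ≡ G W
∑-subsetsOf-proper-zero []          G h = +-identityʳ (G [])
∑-subsetsOf-proper-zero (false ∷ W) G h = trans (∑-map (false ∷_) (subsetsOf W) G)
  (∑-subsetsOf-proper-zero W (λ T → G (false ∷ T)) (λ T s T≢W → h (false ∷ T) (skip s) (T≢W ∘ ∷-injectiveʳ)))
∑-subsetsOf-proper-zero (true ∷ W)  G h = begin
  ∑ (map (false ∷_) (subsetsOf W) ++ map (true ∷_) (subsetsOf W)) G
    ≡⟨ ∑-++ (map (false ∷_) (subsetsOf W)) _ G ⟩
  ∑ (map (false ∷_) (subsetsOf W)) G + ∑ (map (true ∷_) (subsetsOf W)) G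
    ≡⟨ cong₂ _+_ (∑-map (false ∷_) (subsetsOf W) G) (∑-map (true ∷_) (subsetsOf W) G) ⟩
  ∑ (subsetsOf W) (λ T → G (false ∷ T)) + ∑ (subsetsOf W) (λ T → G (true ∷ T))
    ≡⟨ cong₂ _+_ (∑-zero-∈ (subsetsOf W) _ (λ T T∈ → h (false ∷ T) (skip (∈-subsetsOf⇒⊑ W T∈)) (λ ())))
                 (∑-subsetsOf-proper-zero W (λ T → G (true ∷ T))
                    (λ T s T≢W → h (true ∷ T) (keep s) (T≢W ∘ ∷-injectiveʳ))) ⟩
  0ℚ + G (true ∷ W)
    ≡⟨ +-identityˡ _ ⟩
  G (true ∷ W) ∎
  where open ≡-Reasoning

∑-subsetsOf-restrict : ∀ {a W : Subset n} → a ⊑ W → (G : Subset n → ℚ) →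
  ∑ (subsetsOf W) (λ T → 𝟙 (T ⊆ᵇ a) * G T) ≡ ∑ (subsetsOf a) G
∑-subsetsOf-restrict [] G = cong (_+ 0ℚ) (*-identityˡ (G []))
∑-subsetsOf-restrict (skip {b = false} {T = a} {W} s) G =
  trans (∑-map (false ∷_) (subsetsOf W) _)
  (trans (∑-subsetsOf-restrict s (λ T → G (false ∷ T))) (sym (∑-map (false ∷_) (subsetsOf a) G)))
∑-subsetsOf-restrict (skip {b = true} {T = a} {W} s) G = begin
  ∑ (map (false ∷_) (subsetsOf W) ++ map (true ∷_) (subsetsOf W)) G'
    ≡⟨ ∑-++ (map (false ∷_) (subsetsOf W)) _ _ ⟩
  ∑ (map (false ∷_) (subsetsOf W)) G' + ∑ (map (true ∷_) (subsetsOf W)) G'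
    ≡⟨ cong₂ _+_ (∑-map (false ∷_) (subsetsOf W) _) (∑-map (true ∷_) (subsetsOf W) _) ⟩
  ∑ (subsetsOf W) (λ T → G' (false ∷ T)) + ∑ (subsetsOf W) (λ T → 0ℚ * G (true ∷ T))
    ≡⟨ cong₂ _+_ (∑-subsetsOf-restrict s (λ T → G (false ∷ T)))
                 (trans (∑-cong (subsetsOf W) (λ T → *-zeroˡ (G (true ∷ T)))) (∑-zero (subsetsOf W))) ⟩
  ∑ (subsetsOf a) (λ T → G (false ∷ T)) + 0ℚ
    ≡⟨ +-identityʳ _ ⟩
  ∑ (subsetsOf a) (λ T → G (false ∷ T))
    ≡⟨ ∑-map (false ∷_) (subsetsOf a) G ⟨
  ∑ (subsetsOf (false ∷ a)) G ∎
  where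
  open ≡-Reasoning
  G' : Subset (suc _) → ℚ
  G' T = 𝟙 (T ⊆ᵇ (false ∷ a)) * G T
∑-subsetsOf-restrict (keep {T = a} {W} s) G = begin
  ∑ (map (false ∷_) (subsetsOf W) ++ map (true ∷_) (subsetsOf W)) G'
    ≡⟨ ∑-++ (map (false ∷_) (subsetsOf W)) _ _ ⟩
  ∑ (map (false ∷_) (subsetsOf W)) G' + ∑ (map (true ∷_) (subsetsOf W)) G'
    ≡⟨ cong₂ _+_ (∑-map (false ∷_) (subsetsOf W) _) (∑-map (true ∷_) (subsetsOf W) _) ⟩
  ∑ (subsetsOf W) (λ T → G' (false ∷ T)) + ∑ (subsetsOf W) (λ T → G' (true ∷ T))
    ≡⟨ cong₂ _+_ (∑-subsetsOf-restrict s (λ T → G (false ∷ T))) (∑-subsetsOf-restrict s (λ T → G (true ∷ T))) ⟩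
  ∑ (subsetsOf a) (λ T → G (false ∷ T)) + ∑ (subsetsOf a) (λ T → G (true ∷ T))
    ≡⟨ cong₂ _+_ (∑-map (false ∷_) (subsetsOf a) G) (∑-map (true ∷_) (subsetsOf a) G) ⟨
  ∑ (map (false ∷_) (subsetsOf a)) G + ∑ (map (true ∷_) (subsetsOf a)) G
    ≡⟨ ∑-++ (map (false ∷_) (subsetsOf a)) _ G ⟨
  ∑ (subsetsOf (true ∷ a)) G ∎
  where
  open ≡-Reasoning
  G' : Subset (suc _) → ℚ
  G' T = 𝟙 (T ⊆ᵇ (true ∷ a)) * G T

below : ℕ → List ℕ
below zero    = []
below (suc q) = 0 ∷ map suc (below q)

-- Maps V → {0,…,q−1} vanishing outside W, as vectors of naturals.
mapsOn : Subset n → ℕ → List (Vec ℕ n)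
mapsOn []          q = [] ∷ []
mapsOn (false ∷ W) q = map (0 ∷_) (mapsOn W q)
mapsOn (true ∷ W)  q = concatMap (λ f → map (_∷ f) (below q)) (mapsOn W q)

zeros : ∀ n → Vec ℕ n
zeros zero    = []
zeros (suc n) = 0 ∷ zeros n

shiftOn : Subset n → Vec ℕ n → Vec ℕ n
shiftOn []      []      = []
shiftOn (b ∷ T) (x ∷ g) = (if b then suc x else 0) ∷ shiftOn T g

lookup-shiftOn : (T : Subset n) (g : Vec ℕ n) (v : Fin n) →
  lookup (shiftOn T g) v ≡ (if lookup T v then suc (lookup g v) else 0)
lookup-shiftOn (b ∷ T) (x ∷ g) Fin.zero    = refl
lookup-shiftOn (b ∷ T) (x ∷ g) (Fin.suc v) = lookup-shiftOn T g v

∑-mapsOn-suc : (W : Subset n) (q : ℕ) (F : Vec ℕ n → ℚ) →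
  ∑ (mapsOn W (suc q)) F ≡ ∑ (subsetsOf W) (λ T → ∑ (mapsOn T q) (λ g → F (shiftOn T g)))
∑-mapsOn-suc []          q F = sym (+-identityʳ (F [] + 0ℚ))
∑-mapsOn-suc (false ∷ W) q F =
  trans (∑-map (0 ∷_) (mapsOn W (suc q)) F)
  (trans (∑-mapsOn-suc W q (λ f → F (0 ∷ f)))
  (sym (trans (∑-map (false ∷_) (subsetsOf W) _) (∑-cong (subsetsOf W) (λ T → ∑-map (0 ∷_) (mapsOn T q) _)))))
∑-mapsOn-suc (true ∷ W)  q F = begin
  ∑ (concatMap (λ f → map (_∷ f) (below (suc q))) (mapsOn W (suc q))) F
    ≡⟨ ∑-concatMap _ (mapsOn W (suc q)) F ⟩
  ∑ (mapsOn W (suc q)) (λ f → ∑ (map (_∷ f) (below (suc q))) F)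
    ≡⟨ ∑-cong (mapsOn W (suc q)) (λ f → trans (∑-map (_∷ f) (below (suc q)) F)
                                              (cong (F (0 ∷ f) +_) (∑-map suc (below q) (λ i → F (i ∷ f))))) ⟩
  ∑ (mapsOn W (suc q)) (λ f → F (0 ∷ f) + ∑ (below q) (λ i → F (suc i ∷ f)))
    ≡⟨ ∑-+ (mapsOn W (suc q)) _ _ ⟩
  ∑ (mapsOn W (suc q)) (λ f → F (0 ∷ f)) + ∑ (mapsOn W (suc q)) (λ f → ∑ (below q) (λ i → F (suc i ∷ f)))
    ≡⟨ cong₂ _+_ (trans (∑-mapsOn-suc W q _) (∑-cong (subsetsOf W) (λ T → sym (∑-map (0 ∷_) (mapsOn T q) _))))
                 (trans (∑-swap (mapsOn W (suc q)) (below q) _) (∑-cong (below q) (λ i → ∑-mapsOn-suc W q _))) ⟩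
  ∑ (subsetsOf W) (λ T → G (false ∷ T))
    + ∑ (below q) (λ i → ∑ (subsetsOf W) (λ T → ∑ (mapsOn T q) (λ g → F (suc i ∷ shiftOn T g))))
    ≡⟨ cong (∑ (subsetsOf W) (λ T → G (false ∷ T)) +_) (trans (∑-swap (below q) (subsetsOf W) _)
         (∑-cong (subsetsOf W) (λ T → sym (trans (∑-concatMap _ (mapsOn T q) _)
           (trans (∑-cong (mapsOn T q) (λ g → ∑-map (_∷ g) (below q) _)) (∑-swap (mapsOn T q) (below q) _)))))) ⟩
  ∑ (subsetsOf W) (λ T → G (false ∷ T)) + ∑ (subsetsOf W) (λ T → G (true ∷ T))
    ≡⟨ cong₂ _+_ (∑-map (false ∷_) (subsetsOf W) G) (∑-map (true ∷_) (subsetsOf W) G) ⟨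
  ∑ (map (false ∷_) (subsetsOf W)) G + ∑ (map (true ∷_) (subsetsOf W)) G
    ≡⟨ ∑-++ (map (false ∷_) (subsetsOf W)) _ G ⟨
  ∑ (subsetsOf (true ∷ W)) G ∎
  where
  open ≡-Reasoning
  G : Subset (suc _) → ℚ
  G T = ∑ (mapsOn T q) (λ g → F (shiftOn T g))

∑-mapsOn-0 : (W : Subset n) (F : Vec ℕ n → ℚ) → ∑ (mapsOn W 0) F ≡ 𝟙 (empty? W) * F (zeros n)
∑-mapsOn-0 []          F = trans (+-identityʳ (F [])) (sym (*-identityˡ (F [])))
∑-mapsOn-0 (false ∷ W) F = trans (∑-map (0 ∷_) (mapsOn W 0) F) (∑-mapsOn-0 W (λ f → F (0 ∷ f)))
∑-mapsOn-0 (true ∷ W)  F = trans (no-values (mapsOn W 0)) (sym (*-zeroˡ (F (zeros (suc _)))))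
  where
  no-values : (fs : List (Vec ℕ _)) → ∑ (concatMap (λ f → map (_∷ f) (below 0)) fs) F ≡ 0ℚ
  no-values []       = refl
  no-values (f ∷ fs) = no-values fs

module OrderCounts {n : ℕ} (A : List (Arc n)) where

  descendsOn : Subset n → Vec ℕ n → Arc n → Bool
  descendsOn W f (a , b) = not (lookup W a ∧ lookup W b) ∨ not (lookup f a <ᵇ lookup f b)

  -- Bsum A q 0 1 is Ω ⊤ q; restricting to subsets W makes the count recursive in q (Ω-suc).
  Ω : Subset n → ℕ → ℚ
  Ω W q = ∑ (mapsOn W q) (λ f → 𝟙 (allᵇ (descendsOn W f) A))

  predClosedAt : Subset n → Subset n → Arc n → Bool
  predClosedAt W T (a , b) = not (lookup T b ∧ lookup W a) ∨ lookup T a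

  predClosedIn : Subset n → Subset n → Bool
  predClosedIn W T = allᵇ (predClosedAt W T) A

  predClosedIn-refl : ∀ W → predClosedIn W W ≡ true
  predClosedIn-refl W = allᵇ-intro _ A (λ { {a , b} _ → lem (lookup W a) (lookup W b) })
    where
    lem : ∀ x y → (not (y ∧ x) ∨ x) ≡ true
    lem true  true  = refl
    lem true  false = refl
    lem false true  = refl
    lem false false = refl

  descendsOn-shiftOn : ∀ {T W} (g : Vec ℕ n) → T ⊑ W → ∀ e →
    descendsOn W (shiftOn T g) e ≡ predClosedAt W T e ∧ descendsOn T g e
  descendsOn-shiftOn {T} {W} g T⊑W (a , b)
    rewrite lookup-shiftOn T g a | lookup-shiftOn T g b =
    truth-table (lookup T a) (lookup T b) (lookup W a) (lookup W b) (lookup g a) (lookup g b)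
                (⊑-lookup T⊑W a) (⊑-lookup T⊑W b)
    where
    truth-table : ∀ ta tb wa wb x y → (ta ≡ true → wa ≡ true) → (tb ≡ true → wb ≡ true) →
      (not (wa ∧ wb) ∨ not ((if ta then suc x else 0) <ᵇ (if tb then suc y else 0)))
        ≡ ((not (tb ∧ wa) ∨ ta) ∧ (not (ta ∧ tb) ∨ not (x <ᵇ y)))
    truth-table true  true  true  true  x y _ _ = refl
    truth-table true  false true  true  x y _ _ = refl
    truth-table true  false true  false x y _ _ = refl
    truth-table false true  true  true  x y _ _ = refl
    truth-table false true  false true  x y _ _ = refl
    truth-table false false true  true  x y _ _ = refl
    truth-table false false true  false x y _ _ = refl
    truth-table false false false true  x y _ _ = refl
    truth-table false false false false x y _ _ = refl
    truth-table true  _     false _     x y ha _ with () ← ha refl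
    truth-table _     true  _     false x y _ hb with () ← hb refl

  -- Write f as shiftOn T g with T the support of f.
  Ω-suc : ∀ W q → Ω W (suc q) ≡ ∑ (subsetsOf W) (λ T → 𝟙 (predClosedIn W T) * Ω T q)
  Ω-suc W q = trans (∑-mapsOn-suc W q _) (∑-cong-∈ (subsetsOf W) (λ T T∈ →
    trans (∑-cong (mapsOn T q) (λ g → trans
            (cong 𝟙 (trans (allᵇ-cong-∈ A (λ e _ → descendsOn-shiftOn g (∈-subsetsOf⇒⊑ W T∈) e)) (allᵇ-∧ _ _ A)))
            (𝟙-∧ (predClosedIn W T) _)))
          (∑-*ˡ (mapsOn T q) (𝟙 (predClosedIn W T)) _)))

  Ω-zero : ∀ W → Ω W 0 ≡ 𝟙 (empty? W)
  Ω-zero W = trans (∑-mapsOn-0 W _) (lem (empty? W) refl)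
    where
    lem : ∀ e → empty? W ≡ e → 𝟙 e * 𝟙 (allᵇ (descendsOn W (zeros n)) A) ≡ 𝟙 e
    lem false _ = *-zeroˡ (𝟙 (allᵇ (descendsOn W (zeros n)) A))
    lem true  e = trans (cong (λ t → 1ℚ * 𝟙 t) (allᵇ-intro _ A λ { {a , b} _ →
                           cong (λ t → not (t ∧ lookup W b) ∨ _) (empty?-lookup W e a) }))
                        (*-identityˡ 1ℚ)

  -- Coefficients of Ω W in the falling-factorial basis, forced by the recursion Ω-suc
  -- through ∑<-falling-Δ; they are defined for every W at once by recursion on the index.
  coeff : ℕ → Subset n → ℚ
  coeff zero    W = 𝟙 (empty? W)
  coeff (suc j) W = recip-suc j * (∑ (subsetsOf W) (λ T → 𝟙 (predClosedIn W T) * coeff j T) - coeff j W)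

  coeff-Δ : ∀ j W →
    ∑ (subsetsOf W) (λ T → 𝟙 (predClosedIn W T) * coeff j T) ≡ coeff j W + ℕtoℚ (suc j) * coeff (suc j) W
  coeff-Δ j W = trans (solve 2 (λ d c → d := c :+ con 1ℚ :* (d :- c)) refl D (coeff j W))
    (cong (coeff j W +_) (trans (cong (_* (D - coeff j W)) (sym (ℕtoℚ-suc-*-recip-suc j)))
                                 (*-assoc (ℕtoℚ (suc j)) (recip-suc j) _)))
    where
    D : ℚ
    D = ∑ (subsetsOf W) (λ T → 𝟙 (predClosedIn W T) * coeff j T)

  coeff-vanishes : ∀ j W → size W ℕ.< j → coeff j W ≡ 0ℚ
  coeff-vanishes (suc j) W (ℕ.s≤s |W|≤j) = begin
    recip-suc j * (∑ (subsetsOf W) (λ T → 𝟙 (predClosedIn W T) * coeff j T) - coeff j W)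
      ≡⟨ cong (λ t → recip-suc j * (t - coeff j W)) (∑-subsetsOf-proper-zero W _ proper-vanish) ⟩
    recip-suc j * (𝟙 (predClosedIn W W) * coeff j W - coeff j W)
      ≡⟨ cong (λ t → recip-suc j * (𝟙 t * coeff j W - coeff j W)) (predClosedIn-refl W) ⟩
    recip-suc j * (1ℚ * coeff j W - coeff j W)
      ≡⟨ solve 2 (λ i c → i :* (con 1ℚ :* c :- c) := con 0ℚ) refl (recip-suc j) (coeff j W) ⟩
    0ℚ ∎
    where
    open ≡-Reasoning
    proper-vanish : ∀ T → T ⊑ W → ¬ T ≡ W → 𝟙 (predClosedIn W T) * coeff j T ≡ 0ℚ
    proper-vanish T T⊑W T≢W with ⊑⇒≡⊎size-< T⊑W
    ... | inj₁ T≡W = ⊥-elim (T≢W T≡W)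
    ... | inj₂ lt  = trans (cong (𝟙 (predClosedIn W T) *_) (coeff-vanishes j T (ℕ.<-≤-trans lt |W|≤j)))
                           (*-zeroʳ (𝟙 (predClosedIn W T)))

  Ω̂ : Subset n → ℚ → ℚ
  Ω̂ W x = ∑< (suc n) (λ j → coeff j W * falling j x)

  Ω̂-suc : ∀ W x → Ω̂ W (x + 1ℚ) ≡ ∑ (subsetsOf W) (λ T → 𝟙 (predClosedIn W T) * Ω̂ T x)
  Ω̂-suc W x = begin
    Ω̂ W (x + 1ℚ)
      ≡⟨ ∑<-falling-Δ n (λ j → coeff j W) x ⟩
    ∑< (suc n) (λ j → coeff j W * falling j x) + ∑< n (λ j → ℕtoℚ (suc j) * coeff (suc j) W * falling j x)
      ≡⟨ cong (∑< (suc n) (λ j → coeff j W * falling j x) +_) (sym top-vanishes) ⟩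
    ∑< (suc n) (λ j → coeff j W * falling j x) + ∑< (suc n) (λ j → ℕtoℚ (suc j) * coeff (suc j) W * falling j x)
      ≡⟨ ∑<-+ (suc n) _ _ ⟨
    ∑< (suc n) (λ j → coeff j W * falling j x + ℕtoℚ (suc j) * coeff (suc j) W * falling j x)
      ≡⟨ ∑<-cong (suc n) (λ j → trans
           (solve 4 (λ c k c' f → c :* f :+ k :* c' :* f := (c :+ k :* c') :* f) refl
                  (coeff j W) (ℕtoℚ (suc j)) (coeff (suc j) W) (falling j x))
           (cong (_* falling j x) (sym (coeff-Δ j W)))) ⟩
    ∑< (suc n) (λ j → ∑ (subsetsOf W) (λ T → 𝟙 (predClosedIn W T) * coeff j T) * falling j x)
      ≡⟨ ∑<-cong (suc n) (λ j → sym (trans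
           (∑-cong (subsetsOf W) (λ T → sym (*-assoc (𝟙 (predClosedIn W T)) (coeff j T) (falling j x))))
           (∑-*ʳ (subsetsOf W) (falling j x) (λ T → 𝟙 (predClosedIn W T) * coeff j T)))) ⟩
    ∑< (suc n) (λ j → ∑ (subsetsOf W) (λ T → 𝟙 (predClosedIn W T) * (coeff j T * falling j x)))
      ≡⟨ ∑-∑< (subsetsOf W) (suc n) (λ T j → 𝟙 (predClosedIn W T) * (coeff j T * falling j x)) ⟨
    ∑ (subsetsOf W) (λ T → ∑< (suc n) (λ j → 𝟙 (predClosedIn W T) * (coeff j T * falling j x)))
      ≡⟨ ∑-cong (subsetsOf W) (λ T → ∑<-*ˡ (suc n) (𝟙 (predClosedIn W T)) (λ j → coeff j T * falling j x)) ⟩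
    ∑ (subsetsOf W) (λ T → 𝟙 (predClosedIn W T) * Ω̂ T x) ∎
    where
    open ≡-Reasoning
    top-vanishes : ∑< (suc n) (λ j → ℕtoℚ (suc j) * coeff (suc j) W * falling j x)
                 ≡ ∑< n (λ j → ℕtoℚ (suc j) * coeff (suc j) W * falling j x)
    top-vanishes = trans
      (cong (∑< n (λ j → ℕtoℚ (suc j) * coeff (suc j) W * falling j x) +_)
            (trans (cong (λ t → ℕtoℚ (suc n) * t * falling n x) (coeff-vanishes (suc n) W (ℕ.s≤s (size-≤ W))))
                   (solve 2 (λ k f → k :* con 0ℚ :* f := con 0ℚ) refl (ℕtoℚ (suc n)) (falling n x))))
      (+-identityʳ _)

  Ω̂-0 : ∀ W → Ω̂ W 0ℚ ≡ 𝟙 (empty? W)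
  Ω̂-0 W = trans (∑<-head n (λ j → coeff j W * falling j 0ℚ)
                   (λ j → trans (cong (coeff (suc j) W *_) (falling-suc-0 j)) (*-zeroʳ (coeff (suc j) W))))
                (*-identityʳ _)

  Ω̂-ℕ : ∀ q W → Ω̂ W (ℕtoℚ q) ≡ Ω W q
  Ω̂-ℕ zero    W = trans (Ω̂-0 W) (sym (Ω-zero W))
  Ω̂-ℕ (suc q) W = trans (cong (Ω̂ W) (ℕtoℚ-suc q)) (trans (Ω̂-suc W (ℕtoℚ q))
    (trans (∑-cong (subsetsOf W) (λ T → cong (𝟙 (predClosedIn W T) *_) (Ω̂-ℕ q T))) (sym (Ω-suc W q))))

  Ω̂P : Subset n → Poly
  Ω̂P W = ∑<P (suc n) (λ j → scaleP (coeff j W) (fallingP j))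

  eval-Ω̂P : ∀ W x → eval (Ω̂P W) x ≡ Ω̂ W x
  eval-Ω̂P W x = trans (eval-∑<P (suc n) _ x)
    (∑<-cong (suc n) (λ j → trans (eval-scaleP (coeff j W) (fallingP j) x) (cong (coeff j W *_) (eval-fallingP j x))))

  χ : Subset n → ℚ
  χ W = Ω̂ W (- 1ℚ)

  χ-recursion : ∀ W → ∑ (subsetsOf W) (λ T → 𝟙 (predClosedIn W T) * χ T) ≡ 𝟙 (empty? W)
  χ-recursion W = trans (sym (Ω̂-suc W (- 1ℚ))) (Ω̂-0 W)

module Reachability {n : ℕ} (A : List (Arc n)) where
  open OrderCounts A

  Reach : Fin n → Fin n → Set
  Reach = Star (λ x y → (x , y) ∈ A)

  arc⇒Reach : ∀ {x y} → (x , y) ∈ A → Reach x y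
  arc⇒Reach x⟶y = x⟶y ◅ ε

  PredClosed : Subset n → Set
  PredClosed T = ∀ {a b} → (a , b) ∈ A → lookup T b ≡ true → lookup T a ≡ true

  predClosed? : Subset n → Bool
  predClosed? T = allᵇ (λ { (a , b) → not (lookup T b) ∨ lookup T a }) A

  predClosed?⇒PredClosed : ∀ T → predClosed? T ≡ true → PredClosed T
  predClosed?⇒PredClosed T e {a} {b} a⟶b Tb with allᵇ-true-∈ _ A e a⟶b
  ... | Ta rewrite Tb = Ta

  PredClosed-Reach : ∀ T → PredClosed T → ∀ {p w} → Reach p w → lookup T w ≡ true → lookup T p ≡ true
  PredClosed-Reach T C ε            e = e
  PredClosed-Reach T C (p⟶x ◅ x↝w) e = C p⟶x (PredClosed-Reach T C x↝w e)

  predClosedIn≡predClosed? : ∀ {W T} → PredClosed W → T ⊑ W → predClosedIn W T ≡ predClosed? T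
  predClosedIn≡predClosed? {W} {T} CW T⊑W = allᵇ-cong-∈ A (λ { (x , y) x⟶y → lem x y x⟶y })
    where
    lem : ∀ x y → (x , y) ∈ A → (not (lookup T y ∧ lookup W x) ∨ lookup T x) ≡ (not (lookup T y) ∨ lookup T x)
    lem x y x⟶y with lookup T y in Ty
    ... | false = refl
    ... | true rewrite CW x⟶y (⊑-lookup T⊑W y Ty) = refl

  EntersAcyclically : Subset n → Set
  EntersAcyclically T = Any (λ { (p , w) → lookup T w ≡ true × ¬ Reach w p }) A

  module WithDecidableReach (_↝?_ : ∀ x y → Dec (Reach x y)) where

    reaches : Fin n → Fin n → Bool
    reaches x y = isYes (x ↝? y)

    reaches⇒Reach : ∀ {x y} → reaches x y ≡ true → Reach x y
    reaches⇒Reach {x} {y} e with x ↝? y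
    ... | yes r = r

    Reach⇒reaches : ∀ {x y} → Reach x y → reaches x y ≡ true
    Reach⇒reaches {x} {y} r with x ↝? y
    ... | yes _ = refl
    ... | no ¬r = ⊥-elim (¬r r)

    ¬reaches⇒¬Reach : ∀ {x y} → reaches x y ≡ false → ¬ Reach x y
    ¬reaches⇒¬Reach {x} {y} e r with x ↝? y
    ¬reaches⇒¬Reach () r | yes _
    ... | no ¬r = ¬r r

    -- v lies in an initial strong component.
    initial? : Fin n → Bool
    initial? v = allᵇ (λ p → not (reaches p v) ∨ reaches v p) (allFin n)

    initial?⇒ : ∀ {v} → initial? v ≡ true → ∀ {p} → Reach p v → Reach v p
    initial?⇒ {v} e {p} p↝v with allᵇ-true-∈ _ (allFin n) e (∈-allFin p)
    ... | q rewrite Reach⇒reaches p↝v = reaches⇒Reach q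

    ¬initial?⇒ : ∀ {v} → initial? v ≡ false → Σ (Fin n) (λ p → Reach p v × ¬ Reach v p)
    ¬initial?⇒ {v} e with allᵇ-false-∈ _ (allFin n) e
    ... | p , _ , q with reaches p v in e₁ | reaches v p in e₂
    ... | true  | false = p , reaches⇒Reach e₁ , ¬reaches⇒¬Reach e₂
    ¬initial?⇒ e | p , _ , () | true  | true
    ¬initial?⇒ e | p , _ , () | false | _

    initialPart : Subset n → Subset n
    initialPart W = tabulate (λ v → lookup W v ∧ initial? v)

    lookup-initialPart : ∀ W v → lookup (initialPart W) v ≡ lookup W v ∧ initial? v
    lookup-initialPart W v = lookup∘tabulate _ v

    initialPart-⊑ : ∀ W → initialPart W ⊑ W
    initialPart-⊑ W = lookup-⊑ (initialPart W) W (λ v e → proj₁ (∧-≡-true (trans (sym (lookup-initialPart W v)) e)))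

    initialPart-initial : ∀ W v → lookup (initialPart W) v ≡ true → initial? v ≡ true
    initialPart-initial W v e = proj₂ (∧-≡-true (trans (sym (lookup-initialPart W v)) e))

    initial-∈-initialPart : ∀ W v → lookup W v ≡ true → initial? v ≡ true → lookup (initialPart W) v ≡ true
    initial-∈-initialPart W v e₁ e₂ = trans (lookup-initialPart W v) (cong₂ _∧_ e₁ e₂)

    initialPart-PredClosed : ∀ W → PredClosed W → PredClosed (initialPart W)
    initialPart-PredClosed W CW {x} {y} x⟶y y∈ =
      initial-∈-initialPart W x (CW x⟶y (⊑-lookup (initialPart-⊑ W) y y∈)) x-initial
      where
      x-initial : initial? x ≡ true
      x-initial with initial? x in e
      ... | true  = refl
      ... | false with ¬initial?⇒ e
      ...   | p , p↝x , ¬x↝p =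
        ⊥-elim (¬x↝p (arc⇒Reach x⟶y ◅◅ initial?⇒ (initialPart-initial W y y∈) (p↝x ◅◅ arc⇒Reach x⟶y)))

    ancestors : Fin n → Subset n
    ancestors v = tabulate (λ p → reaches p v)

    ancestors-shrink : ∀ {p w} → Reach p w → ¬ Reach w p → size (ancestors p) ℕ.< size (ancestors w)
    ancestors-shrink {p} {w} p↝w ¬w↝p with ⊑⇒≡⊎size-< anc-p⊑anc-w
      where
      anc-p⊑anc-w : ancestors p ⊑ ancestors w
      anc-p⊑anc-w = lookup-⊑ (ancestors p) (ancestors w) (λ v e → trans (lookup∘tabulate _ v)
        (Reach⇒reaches (reaches⇒Reach (trans (sym (lookup∘tabulate _ v)) e) ◅◅ p↝w)))
    ... | inj₂ lt = lt
    ... | inj₁ eq = ⊥-elim (¬w↝p (reaches⇒Reach (trans (sym (lookup∘tabulate _ w))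
                      (trans (cong (λ t → lookup t w) eq) (trans (lookup∘tabulate _ w) (Reach⇒reaches ε))))))

    -- Walk backwards to strictly fewer ancestors until an initial vertex is met.
    initial-below : ∀ k W w → size (ancestors w) ℕ.< k → PredClosed W → lookup W w ≡ true →
      Σ (Fin n) (λ v → lookup W v ≡ true × initial? v ≡ true)
    initial-below (suc k) W w lt CW w∈ with initial? w in e
    ... | true  = w , w∈ , e
    ... | false with ¬initial?⇒ e
    ...   | p , p↝w , ¬w↝p = initial-below k W p (ℕ.<-≤-trans (ancestors-shrink p↝w ¬w↝p) (ℕ.≤-pred lt)) CW
                                (PredClosed-Reach W CW p↝w w∈)

    initialPart-nonempty : ∀ {W} w → PredClosed W → lookup W w ≡ true → empty? (initialPart W) ≡ false
    initialPart-nonempty {W} w CW w∈ with initial-below (suc (size (ancestors w))) W w ℕ.≤-refl CW w∈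
    ... | v , v∈ , v-initial = lookup-empty? (initialPart W) v (initial-∈-initialPart W v v∈ v-initial)

    EntersAcyclically? : ∀ T → Dec (EntersAcyclically T)
    EntersAcyclically? T = any? (λ { (p , w) → dec p w }) A
      where
      dec : ∀ p w → Dec (lookup T w ≡ true × ¬ Reach w p)
      dec p w with lookup T w ≟ᵇ true | w ↝? p
      ... | yes w∈ | yes w↝p = no (λ z → proj₂ z w↝p)
      ... | yes w∈ | no ¬w↝p = yes (w∈ , ¬w↝p)
      ... | no w∉  | _        = no (λ z → w∉ (proj₁ z))

    ⊑-initialPart : ∀ {W T} → T ⊑ W → PredClosed T → ¬ EntersAcyclically T → T ⊑ initialPart W
    ⊑-initialPart {W} {T} T⊑W CT ¬enters =
      lookup-⊑ T (initialPart W) (λ v v∈ → initial-∈-initialPart W v (⊑-lookup T⊑W v v∈) (v-initial v v∈))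
      where
      back : ∀ {p v} → Reach p v → lookup T v ≡ true → Reach v p
      back ε e = ε
      back {p} (_◅_ {j = y} p⟶y y↝v) e with y ↝? p
      ... | yes y↝p = back y↝v e ◅◅ y↝p
      ... | no ¬y↝p = ⊥-elim (¬enters (lose p⟶y (PredClosed-Reach T CT y↝v e , ¬y↝p)))
      v-initial : ∀ v → lookup T v ≡ true → initial? v ≡ true
      v-initial v v∈ with initial? v in e
      ... | true  = refl
      ... | false with ¬initial?⇒ e
      ...   | p , p↝v , ¬v↝p = ⊥-elim (¬v↝p (back p↝v v∈))

    -- In χ-recursion for W, the terms with T inside the initial part of W add up to
    -- 𝟙 (empty? (initialPart W)) = 0, and of the others only T = W escapes the induction hypothesis.
    χ-vanishes-step : ∀ W → (∀ T → T ⊑ W → ¬ T ≡ W → PredClosed T → EntersAcyclically T → χ T ≡ 0ℚ) →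
      PredClosed W → EntersAcyclically W → χ W ≡ 0ℚ
    χ-vanishes-step W IH CW enters with find enters
    ... | (p , w) , p⟶w , w∈ , ¬w↝p = begin
      χ W                                                              ≡⟨ +-identityˡ (χ W) ⟨
      0ℚ + χ W                                                         ≡⟨ cong₂ _+_ inside outside ⟨
      ∑ (subsetsOf W) (λ T → 𝟙 (predClosedIn W T ∧ T ⊆ᵇ a) * χ T)
        + ∑ (subsetsOf W) (λ T → 𝟙 (predClosedIn W T ∧ not (T ⊆ᵇ a)) * χ T) ≡⟨ ∑-+ (subsetsOf W) _ _ ⟨
      ∑ (subsetsOf W) (λ T → 𝟙 (predClosedIn W T ∧ T ⊆ᵇ a) * χ T
                            + 𝟙 (predClosedIn W T ∧ not (T ⊆ᵇ a)) * χ T)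
        ≡⟨ ∑-cong (subsetsOf W) (λ T → 𝟙-split (predClosedIn W T) (T ⊆ᵇ a) (χ T)) ⟨
      ∑ (subsetsOf W) (λ T → 𝟙 (predClosedIn W T) * χ T)               ≡⟨ χ-recursion W ⟩
      𝟙 (empty? W)                                                     ≡⟨ cong 𝟙 (lookup-empty? W w w∈) ⟩
      0ℚ                                                               ∎
      where
      open ≡-Reasoning
      a : Subset n
      a = initialPart W

      W⊈a : W ⊆ᵇ a ≡ false
      W⊈a with W ⊆ᵇ a in e
      ... | false = refl
      ... | true  =
        ⊥-elim (¬w↝p (initial?⇒ (initialPart-initial W w (⊑-lookup (⊆ᵇ⇒⊑ W a e) w w∈)) (arc⇒Reach p⟶w)))

      inside-term : ∀ T → T ⊑ W →
        𝟙 (predClosedIn W T ∧ T ⊆ᵇ a) * χ T ≡ 𝟙 (T ⊆ᵇ a) * (𝟙 (predClosedIn a T) * χ T)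
      inside-term T T⊑W rewrite predClosedIn≡predClosed? CW T⊑W with T ⊆ᵇ a in e
      ... | false = trans (cong (λ t → 𝟙 t * χ T) (∧-zeroʳ (predClosed? T)))
                          (trans (*-zeroˡ (χ T)) (sym (*-zeroˡ (𝟙 (predClosedIn a T) * χ T))))
      ... | true rewrite predClosedIn≡predClosed? (initialPart-PredClosed W CW) (⊆ᵇ⇒⊑ T a e)
                       | ∧-identityʳ (predClosed? T) = sym (*-identityˡ _)

      inside : ∑ (subsetsOf W) (λ T → 𝟙 (predClosedIn W T ∧ T ⊆ᵇ a) * χ T) ≡ 0ℚ
      inside = trans (∑-cong-∈ (subsetsOf W) (λ T T∈ → inside-term T (∈-subsetsOf⇒⊑ W T∈)))
              (trans (∑-subsetsOf-restrict (initialPart-⊑ W) (λ T → 𝟙 (predClosedIn a T) * χ T))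
              (trans (χ-recursion a) (cong 𝟙 (initialPart-nonempty {W} w CW w∈))))

      outside-term : ∀ T → T ⊑ W → ¬ T ≡ W → 𝟙 (predClosedIn W T ∧ not (T ⊆ᵇ a)) * χ T ≡ 0ℚ
      outside-term T T⊑W T≢W with predClosedIn W T ∧ not (T ⊆ᵇ a) in e
      ... | false = *-zeroˡ (χ T)
      ... | true  = trans (*-identityˡ (χ T)) (IH T T⊑W T≢W CT (T-enters-acyclically))
        where
        CT : PredClosed T
        CT = predClosed?⇒PredClosed T (trans (sym (predClosedIn≡predClosed? CW T⊑W)) (proj₁ (∧-≡-true e)))
        T-enters-acyclically : EntersAcyclically T
        T-enters-acyclically with EntersAcyclically? T
        ... | yes t = t
        ... | no ¬t with trans (cong not (sym (⊑⇒⊆ᵇ (⊑-initialPart T⊑W CT ¬t)))) (proj₂ (∧-≡-true e))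
        ...   | ()

      outside : ∑ (subsetsOf W) (λ T → 𝟙 (predClosedIn W T ∧ not (T ⊆ᵇ a)) * χ T) ≡ χ W
      outside = trans (∑-subsetsOf-proper-zero W _ outside-term)
        (trans (cong (λ t → 𝟙 (t ∧ not (W ⊆ᵇ a)) * χ W) (predClosedIn-refl W))
        (trans (cong (λ t → 𝟙 (not t) * χ W) W⊈a) (*-identityˡ (χ W))))

    χ-vanishes : ∀ W → PredClosed W → EntersAcyclically W → χ W ≡ 0ℚ
    χ-vanishes W = go (suc (size W)) W ℕ.≤-refl
      where
      go : ∀ k W → size W ℕ.< k → PredClosed W → EntersAcyclically W → χ W ≡ 0ℚ
      go (suc k) W lt = χ-vanishes-step W (λ T T⊑W T≢W → go k T (size-< T⊑W T≢W))
        where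
        size-< : ∀ {T} → T ⊑ W → ¬ T ≡ W → size T ℕ.< k
        size-< T⊑W T≢W with ⊑⇒≡⊎size-< T⊑W
        ... | inj₁ T≡W = ⊥-elim (T≢W T≡W)
        ... | inj₂ T<W = ℕ.<-≤-trans T<W (ℕ.≤-pred lt)

1^ℚ : ∀ k → 1ℚ ^ℚ k ≡ 1ℚ
1^ℚ zero    = refl
1^ℚ (suc k) = cong (1ℚ *_) (1^ℚ k)

0^ℚ-length-filter : (p : X → Bool) (xs : List X) →
  0ℚ ^ℚ length (filterᵇ p xs) ≡ 𝟙 (allᵇ (λ x → not (p x)) xs)
0^ℚ-length-filter p []       = refl
0^ℚ-length-filter p (x ∷ xs) with p x
... | true  = *-zeroˡ (0ℚ ^ℚ length (filterᵇ p xs))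
... | false = 0^ℚ-length-filter p xs

noAscent : ∀ {q} → List (Arc n) → Vec (Fin q) n → Bool
noAscent A f = allᵇ (λ { (a , b) → not (toℕ (lookup f a) <ᵇ toℕ (lookup f b)) }) A

Bsum-0-1 : (A : List (Arc n)) (q : ℕ) → Bsum A q 0ℚ 1ℚ ≡ ∑ (allMaps n q) (λ f → 𝟙 (noAscent A f))
Bsum-0-1 A q = ∑-cong (allMaps _ q) (λ f → trans (cong ((0ℚ ^ℚ ascents A f) *_) (1^ℚ (descents A f)))
  (trans (*-identityʳ _) (0^ℚ-length-filter _ A)))

∑-allFin-suc : ∀ q (f : Fin (suc q) → ℚ) → ∑ (allFin (suc q)) f ≡ f Fin.zero + ∑ (allFin q) (λ i → f (Fin.suc i))
∑-allFin-suc q f = cong (f Fin.zero +_) (trans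
  (cong (λ l → ∑ l f) (sym (map-tabulate {n = q} (λ i → i) Fin.suc))) (∑-map Fin.suc (allFin q) f))

∑-allFin : ∀ q (K : ℕ → ℚ) → ∑ (allFin q) (λ i → K (toℕ i)) ≡ ∑ (below q) K
∑-allFin zero    K = refl
∑-allFin (suc q) K = trans (∑-allFin-suc q (λ i → K (toℕ i)))
  (cong (K 0 +_) (trans (∑-allFin q (λ k → K (suc k))) (sym (∑-map suc (below q) K))))

∑-allMaps : ∀ n q (H : Vec ℕ n → ℚ) → ∑ (allMaps n q) (λ f → H (Vec.map toℕ f)) ≡ ∑ (mapsOn ⊤ q) H
∑-allMaps zero    q H = refl
∑-allMaps (suc n) q H = begin
  ∑ (allMaps (suc n) q) (λ f → H (Vec.map toℕ f))
    ≡⟨ ∑-concatMap _ (allMaps n q) _ ⟩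
  ∑ (allMaps n q) (λ f → ∑ (map (λ i → i Vec.∷ f) (allFin q)) (λ f' → H (Vec.map toℕ f')))
    ≡⟨ ∑-cong (allMaps n q) (λ f → ∑-map (λ i → i Vec.∷ f) (allFin q) _) ⟩
  ∑ (allMaps n q) (λ f → ∑ (allFin q) (λ i → H (toℕ i Vec.∷ Vec.map toℕ f)))
    ≡⟨ ∑-swap (allMaps n q) (allFin q) _ ⟩
  ∑ (allFin q) (λ i → ∑ (allMaps n q) (λ f → H (toℕ i Vec.∷ Vec.map toℕ f)))
    ≡⟨ ∑-cong (allFin q) (λ i → ∑-allMaps n q (λ g → H (toℕ i Vec.∷ g))) ⟩
  ∑ (allFin q) (λ i → ∑ (mapsOn (⊤ {n}) q) (λ g → H (toℕ i Vec.∷ g)))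
    ≡⟨ ∑-allFin q (λ k → ∑ (mapsOn (⊤ {n}) q) (λ g → H (k Vec.∷ g))) ⟩
  ∑ (below q) (λ k → ∑ (mapsOn (⊤ {n}) q) (λ g → H (k Vec.∷ g)))
    ≡⟨ ∑-swap (mapsOn (⊤ {n}) q) (below q) _ ⟨
  ∑ (mapsOn (⊤ {n}) q) (λ g → ∑ (below q) (λ k → H (k Vec.∷ g)))
    ≡⟨ ∑-cong (mapsOn (⊤ {n}) q) (λ g → ∑-map (Vec._∷ g) (below q) H) ⟨
  ∑ (mapsOn (⊤ {n}) q) (λ g → ∑ (map (Vec._∷ g) (below q)) H)
    ≡⟨ ∑-concatMap _ (mapsOn (⊤ {n}) q) H ⟨
  ∑ (mapsOn (⊤ {suc n}) q) H ∎
  where open ≡-Reasoning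

Bsum-0-1≡Ω : (A : List (Arc n)) (q : ℕ) → Bsum A q 0ℚ 1ℚ ≡ OrderCounts.Ω A ⊤ q
Bsum-0-1≡Ω {n} A q = trans (Bsum-0-1 A q)
  (trans (∑-cong (allMaps n q) (λ f → cong 𝟙 (allᵇ-cong-∈ A (λ { (a , b) _ → noAscent≡descendsOn f a b }))))
         (∑-allMaps n q (λ g → 𝟙 (allᵇ (OrderCounts.descendsOn A ⊤ g) A))))
  where
  noAscent≡descendsOn : (f : Vec (Fin q) n) (a b : Fin n) →
    not (toℕ (lookup f a) <ᵇ toℕ (lookup f b)) ≡ OrderCounts.descendsOn A ⊤ (Vec.map toℕ f) (a , b)
  noAscent≡descendsOn f a b
    rewrite lookup-replicate a true | lookup-replicate b true | lookup-map a toℕ f | lookup-map b toℕ f = refl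

¬¬-Π-Fin : ∀ {m} {P : Fin m → Set} → (∀ i → ¬ ¬ P i) → ¬ ¬ (∀ i → P i)
¬¬-Π-Fin {zero}      h k = k (λ ())
¬¬-Π-Fin {suc m} {P} h k = h Fin.zero (λ p₀ → ¬¬-Π-Fin {m} {λ i → P (Fin.suc i)} (λ i → h (Fin.suc i))
  (λ ps → k (λ { Fin.zero → p₀ ; (Fin.suc i) → ps i })))

module NonTotallyCyclic {n : ℕ} (A : List (Arc n)) where
  open OrderCounts A
  open Reachability A
  open import Data.List.Membership.DecPropositional (Fin._≟_ {n}) using (_∈?_)

  Path : Fin n → Fin n → Set
  Path x z = Σ (List (Arc n)) λ w → All (_∈ A) w × Walk x w z × Unique (z ∷ map proj₁ w)

  Path-suffix : ∀ {x y z w} → Walk y w z → All (_∈ A) w → Unique (z ∷ map proj₁ w) → x ∈ map proj₁ w → Path x z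
  Path-suffix {w = _ ∷ w} (cons wk) (a ∷ as) u (here refl) = _ , a ∷ as , cons wk , u
  Path-suffix {w = _ ∷ w} (cons wk) (a ∷ as) ((_ ∷ z∉) ∷ (_ ∷ u)) (there x∈) = Path-suffix wk as (z∉ ∷ u) x∈

  -- Prepend the arc x ⟶ y to a path from y, cutting the loop if x already occurs on it.
  Reach⇒Path : ∀ {x z} → Reach x z → Path x z
  Reach⇒Path ε = [] , [] , nil , [] ∷ []
  Reach⇒Path {x} {z} (_◅_ {j = y} x⟶y y↝z) with Reach⇒Path y↝z
  ... | w , as , wk , u with x Fin.≟ z
  ...   | yes refl = [] , [] , nil , [] ∷ []
  ...   | no x≢z with x ∈? map proj₁ w
  ...     | yes x∈ = Path-suffix wk as u x∈
  ...     | no x∉ with u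
  ...       | z∉ ∷ u' =
    (x , y) ∷ w , x⟶y ∷ as , cons wk , ((λ eq → x≢z (sym eq)) ∷ z∉) ∷ (¬Any⇒All¬ _ x∉ ∷ u')

  -- Reachability is decided only under a double negation, which suffices because
  -- the conclusion is a decidable equation in ℚ.
  χ-⊤-vanishes : ¬ TotallyCyclic A → χ ⊤ ≡ 0ℚ
  χ-⊤-vanishes ¬tc = decidable-stable (χ ⊤ ≟ℚ 0ℚ) (λ χ≢0 → ¬¬-decidable (λ dec → χ≢0 (vanishes dec)))
    where
    ¬¬-decidable : ¬ ¬ (∀ x y → Dec (Reach x y))
    ¬¬-decidable = ¬¬-Π-Fin (λ x → ¬¬-Π-Fin (λ y → ¬¬-excluded-middle))

    vanishes : (∀ x y → Dec (Reach x y)) → χ ⊤ ≡ 0ℚ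
    vanishes dec with WithDecidableReach.EntersAcyclically? dec ⊤
    ... | yes enters = WithDecidableReach.χ-vanishes dec ⊤ (λ {a} _ _ → lookup-replicate a true) enters
    ... | no ¬enters = ⊥-elim (¬tc (All.tabulate λ { {(u , v)} u⟶v → on-cycle u v u⟶v }))
      where
      on-cycle : ∀ u v → (u , v) ∈ A → OnDirectedCycle A (u , v)
      on-cycle u v u⟶v with dec v u
      ... | yes v↝u = Reach⇒Path v↝u
      ... | no ¬v↝u = ⊥-elim (¬enters (lose u⟶v (lookup-replicate v true , ¬v↝u)))

  eval-−1-vanishes : (P : Poly) → (∀ q → 1 ℕ.≤ q → eval P (ℕtoℚ q) ≡ Bsum A q 0ℚ 1ℚ) →
    ¬ TotallyCyclic A → eval P (- 1ℚ) ≡ 0ℚ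
  eval-−1-vanishes P hP ¬tc = begin
    eval P (- 1ℚ)     ≡⟨ eval-unique-from-ℕ≥ P (Ω̂P ⊤) 1 agree (- 1ℚ) ⟩
    eval (Ω̂P ⊤) (- 1ℚ) ≡⟨ eval-Ω̂P ⊤ (- 1ℚ) ⟩
    χ ⊤               ≡⟨ χ-⊤-vanishes ¬tc ⟩
    0ℚ                ∎
    where
    open ≡-Reasoning
    agree : ∀ q → 1 ℕ.≤ q → eval P (ℕtoℚ q) ≡ eval (Ω̂P ⊤) (ℕtoℚ q)
    agree q 1≤q = trans (hP q 1≤q) (trans (Bsum-0-1≡Ω A q) (trans (sym (Ω̂-ℕ q ⊤)) (sym (eval-Ω̂P ⊤ (ℕtoℚ q)))))

_≟ᵛ_ : ∀ {q} → DecidableEquality (Vec (Fin q) n)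
_≟ᵛ_ = ≡-dec Fin._≟_

∑-allFin-indicator : ∀ q (h : Fin q) → ∑ (allFin q) (λ i → 𝟙 (does (i Fin.≟ h))) ≡ 1ℚ
∑-allFin-indicator (suc q) Fin.zero = begin
  ∑ (allFin (suc q)) (λ i → 𝟙 (does (i Fin.≟ Fin.zero)))              ≡⟨ ∑-allFin-suc q (λ i → 𝟙 (does (i Fin.≟ Fin.zero))) ⟩
  1ℚ + ∑ (allFin q) (λ i → 𝟙 (does (Fin.suc i Fin.≟ Fin.zero)))       ≡⟨ cong (1ℚ +_) (∑-zero (allFin q)) ⟩
  1ℚ + 0ℚ                                                             ≡⟨ +-identityʳ 1ℚ ⟩
  1ℚ                                                                  ∎
  where open ≡-Reasoning
∑-allFin-indicator (suc q) (Fin.suc h) = begin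
  ∑ (allFin (suc q)) (λ i → 𝟙 (does (i Fin.≟ Fin.suc h)))             ≡⟨ ∑-allFin-suc q (λ i → 𝟙 (does (i Fin.≟ Fin.suc h))) ⟩
  0ℚ + ∑ (allFin q) (λ i → 𝟙 (does (i Fin.≟ h)))                      ≡⟨ +-identityˡ _ ⟩
  ∑ (allFin q) (λ i → 𝟙 (does (i Fin.≟ h)))                           ≡⟨ ∑-allFin-indicator q h ⟩
  1ℚ                                                                  ∎
  where open ≡-Reasoning

∑-allMaps-indicator : ∀ n q (h : Vec (Fin q) n) → ∑ (allMaps n q) (λ f → 𝟙 (does (f ≟ᵛ h))) ≡ 1ℚ
∑-allMaps-indicator zero    q Vec.[] = +-identityʳ 1ℚ
∑-allMaps-indicator (suc n) q (h₀ Vec.∷ h) = begin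
  ∑ (allMaps (suc n) q) (λ f → 𝟙 (does (f ≟ᵛ (h₀ Vec.∷ h))))
    ≡⟨ ∑-concatMap _ (allMaps n q) _ ⟩
  ∑ (allMaps n q) (λ f → ∑ (map (Vec._∷ f) (allFin q)) (λ f' → 𝟙 (does (f' ≟ᵛ (h₀ Vec.∷ h)))))
    ≡⟨ ∑-cong (allMaps n q) (λ f → trans (∑-map (Vec._∷ f) (allFin q) _)
         (trans (∑-cong (allFin q) (λ i → 𝟙-∧ (does (i Fin.≟ h₀)) (does (f ≟ᵛ h))))
         (trans (∑-*ʳ (allFin q) (𝟙 (does (f ≟ᵛ h))) (λ i → 𝟙 (does (i Fin.≟ h₀))))
         (trans (cong (_* 𝟙 (does (f ≟ᵛ h))) (∑-allFin-indicator q h₀)) (*-identityˡ _))))) ⟩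
  ∑ (allMaps n q) (λ f → 𝟙 (does (f ≟ᵛ h)))
    ≡⟨ ∑-allMaps-indicator n q h ⟩
  1ℚ ∎
  where open ≡-Reasoning

∑-below-1 : ∀ q → ∑ (below q) (λ _ → 1ℚ) ≡ ℕtoℚ q
∑-below-1 zero    = refl
∑-below-1 (suc q) = trans (cong (1ℚ +_) (trans (∑-map suc (below q) _) (∑-below-1 q)))
                          (trans (+-comm 1ℚ (ℕtoℚ q)) (sym (ℕtoℚ-suc q)))

∑-allMaps-1 : ∀ c q → ∑ (allMaps c q) (λ _ → 1ℚ) ≡ ℕtoℚ q ^ℚ c
∑-allMaps-1 zero    q = +-identityʳ 1ℚ
∑-allMaps-1 (suc c) q =
  trans (∑-concatMap _ (allMaps c q) (λ _ → 1ℚ))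
  (trans (∑-cong (allMaps c q) (λ g → trans (∑-map (Vec._∷ g) (allFin q) (λ _ → 1ℚ))
            (trans (trans (∑-allFin q (λ _ → 1ℚ)) (∑-below-1 q)) (sym (*-identityʳ (ℕtoℚ q))))))
  (trans (∑-*ˡ (allMaps c q) (ℕtoℚ q) (λ _ → 1ℚ)) (cong (ℕtoℚ q *_) (∑-allMaps-1 c q))))

Adjacent⇒arc : ∀ (es : List (Edge n)) (o : Orientation es) {u w} e → e ∈ es →
  (ends e ≡ (u , w) ⊎ ends e ≡ (w , u)) → (u , w) ∈ orientedArcs o ⊎ (w , u) ∈ orientedArcs o
Adjacent⇒arc (oriented a b ∷ es)   (_ ∷ o)     _ (here refl) (inj₁ refl) = inj₁ (here refl)
Adjacent⇒arc (oriented a b ∷ es)   (_ ∷ o)     _ (here refl) (inj₂ refl) = inj₂ (here refl)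
Adjacent⇒arc (unoriented a b ∷ es) (true ∷ o)  _ (here refl) (inj₁ refl) = inj₁ (here refl)
Adjacent⇒arc (unoriented a b ∷ es) (true ∷ o)  _ (here refl) (inj₂ refl) = inj₂ (here refl)
Adjacent⇒arc (unoriented a b ∷ es) (false ∷ o) _ (here refl) (inj₁ refl) = inj₂ (here refl)
Adjacent⇒arc (unoriented a b ∷ es) (false ∷ o) _ (here refl) (inj₂ refl) = inj₁ (here refl)
Adjacent⇒arc (_ ∷ es) (_ ∷ o) e (there e∈) h with Adjacent⇒arc es o e e∈ h
... | inj₁ x = inj₁ (there x)
... | inj₂ x = inj₂ (there x)

arc⇒Adjacent : ∀ (es : List (Edge n)) (o : Orientation es) {u v} → (u , v) ∈ orientedArcs o → Adjacent es u v
arc⇒Adjacent (oriented a b ∷ es)   (_ ∷ o)     (here refl) = oriented a b , here refl , inj₁ refl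
arc⇒Adjacent (unoriented a b ∷ es) (true ∷ o)  (here refl) = unoriented a b , here refl , inj₁ refl
arc⇒Adjacent (unoriented a b ∷ es) (false ∷ o) (here refl) = unoriented a b , here refl , inj₂ refl
arc⇒Adjacent (_ ∷ es) (_ ∷ o) (there x) with arc⇒Adjacent es o x
... | e , e∈ , h = e , there e∈ , h

module _ {n q : ℕ} (A : List (Arc n)) (f : Vec (Fin q) n) where

  noAscent-arc : noAscent A f ≡ true → ∀ {a b} → (a , b) ∈ A → toℕ (lookup f b) ℕ.≤ toℕ (lookup f a)
  noAscent-arc na a⟶b = not-<ᵇ⇒≥ _ _ (allᵇ-true-∈ _ A na a⟶b)

  -- Along a directed cycle a non-ascending f can only stay constant.
  noAscent-TotallyCyclic-arc : noAscent A f ≡ true → TotallyCyclic A →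
    ∀ {u v} → (u , v) ∈ A → lookup f u ≡ lookup f v
  noAscent-TotallyCyclic-arc na tc u⟶v with All.lookup tc u⟶v
  ... | w , as , wk , _ = Fin.toℕ-injective (ℕ.≤-antisym (walk-≤ wk as) (noAscent-arc na u⟶v))
    where
    walk-≤ : ∀ {x w z} → Walk x w z → All (_∈ A) w → toℕ (lookup f z) ℕ.≤ toℕ (lookup f x)
    walk-≤ nil       []       = ℕ.≤-refl
    walk-≤ (cons wk) (a ∷ as) = ℕ.≤-trans (walk-≤ wk as) (noAscent-arc na a)

  constant-on-arcs⇒noAscent : (∀ {a b} → (a , b) ∈ A → lookup f a ≡ lookup f b) → noAscent A f ≡ true
  constant-on-arcs⇒noAscent h = allᵇ-intro _ A (λ { {(a , b)} a⟶b →
    subst (λ t → not (toℕ (lookup f a) <ᵇ toℕ t) ≡ true) (h a⟶b) (not-<ᵇ-refl (toℕ (lookup f a))) })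

module TotallyCyclicCount {n c : ℕ} (es : List (Edge n)) (o : Orientation es)
                          (nc : NumComponents es c) (tc : TotallyCyclic (orientedArcs o)) where

  private
    A : List (Arc n)
    A = orientedArcs o
    comp : Fin n → Fin c
    comp = proj₁ nc
    rep : Fin c → Fin n
    rep i = proj₁ (proj₁ (proj₂ nc) i)
    comp-rep : ∀ i → comp (rep i) ≡ i
    comp-rep i = proj₂ (proj₁ (proj₂ nc) i)
    same-comp⇔Connected : ∀ u v → (comp u ≡ comp v) ⇔ Connected es u v
    same-comp⇔Connected = proj₂ (proj₂ nc)

  noAscent-Connected : ∀ {q} (f : Vec (Fin q) n) → noAscent A f ≡ true →
    ∀ {u v} → Connected es u v → lookup f u ≡ lookup f v
  noAscent-Connected f na here = refl
  noAscent-Connected f na (step (e , e∈ , h) r) with Adjacent⇒arc es o e e∈ h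
  ... | inj₁ u⟶w = trans (noAscent-TotallyCyclic-arc A f na tc u⟶w) (noAscent-Connected f na r)
  ... | inj₂ w⟶u = trans (sym (noAscent-TotallyCyclic-arc A f na tc w⟶u)) (noAscent-Connected f na r)

  lift : ∀ {q} → Vec (Fin q) c → Vec (Fin q) n
  lift g = tabulate (λ u → lookup g (comp u))

  lookup-lift : ∀ {q} (g : Vec (Fin q) c) u → lookup (lift g) u ≡ lookup g (comp u)
  lookup-lift g u = lookup∘tabulate _ u

  lift-noAscent : ∀ {q} (g : Vec (Fin q) c) → noAscent A (lift g) ≡ true
  lift-noAscent g = constant-on-arcs⇒noAscent A (lift g) (λ {a} {b} a⟶b →
    trans (lookup-lift g a)
      (trans (cong (lookup g) (Equivalence.from (same-comp⇔Connected a b) (step (arc⇒Adjacent es o a⟶b) here)))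
             (sym (lookup-lift g b))))

  lift-injective : ∀ {q} {g h : Vec (Fin q) c} → lift g ≡ lift h → g ≡ h
  lift-injective {g = g} {h} eq =
    trans (sym (tabulate∘lookup g)) (trans (tabulate-cong pointwise) (tabulate∘lookup h))
    where
    pointwise : ∀ i → lookup g i ≡ lookup h i
    pointwise i = begin
      lookup g i              ≡⟨ cong (lookup g) (comp-rep i) ⟨
      lookup g (comp (rep i)) ≡⟨ lookup-lift g (rep i) ⟨
      lookup (lift g) (rep i) ≡⟨ cong (λ t → lookup t (rep i)) eq ⟩
      lookup (lift h) (rep i) ≡⟨ lookup-lift h (rep i) ⟩
      lookup h (comp (rep i)) ≡⟨ cong (lookup h) (comp-rep i) ⟩
      lookup h i              ∎
      where open ≡-Reasoning

  noAscent⇒lift : ∀ {q} (f : Vec (Fin q) n) → noAscent A f ≡ true → f ≡ lift (tabulate (λ i → lookup f (rep i)))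
  noAscent⇒lift f na = trans (sym (tabulate∘lookup f)) (tabulate-cong (λ u → begin
    lookup f u
      ≡⟨ noAscent-Connected f na (Equivalence.to (same-comp⇔Connected u (rep (comp u))) (sym (comp-rep (comp u)))) ⟩
    lookup f (rep (comp u))
      ≡⟨ lookup∘tabulate _ (comp u) ⟨
    lookup (tabulate (λ i → lookup f (rep i))) (comp u) ∎))
    where open ≡-Reasoning

  -- The non-ascending maps are exactly the lifts of maps on components, each lift arising once.
  𝟙-noAscent : ∀ {q} (f : Vec (Fin q) n) →
    𝟙 (noAscent A f) ≡ ∑ (allMaps c q) (λ g → 𝟙 (does (f ≟ᵛ lift g)))
  𝟙-noAscent {q} f with noAscent A f in na
  ... | false = sym (∑-zero-∈ (allMaps c q) _ (λ g _ → cong 𝟙 (dec-false (f ≟ᵛ lift g) (not-lift g))))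
    where
    not-lift : ∀ g → ¬ f ≡ lift g
    not-lift g refl with () ← trans (sym na) (lift-noAscent g)
  ... | true  = sym (trans (∑-cong (allMaps c q) (λ g → cong 𝟙 (does-⇔ (mk⇔ to from) (f ≟ᵛ lift g) (g ≟ᵛ g₀))))
                           (∑-allMaps-indicator c q g₀))
    where
    g₀ : Vec (Fin q) c
    g₀ = tabulate (λ i → lookup f (rep i))
    to : ∀ {g} → f ≡ lift g → g ≡ g₀
    to f≡ = lift-injective (trans (sym f≡) (noAscent⇒lift f na))
    from : ∀ {g} → g ≡ g₀ → f ≡ lift g
    from refl = noAscent⇒lift f na

  Bsum-totallyCyclic : ∀ q → Bsum A q 0ℚ 1ℚ ≡ ℕtoℚ q ^ℚ c
  Bsum-totallyCyclic q = begin
    Bsum A q 0ℚ 1ℚ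
      ≡⟨ Bsum-0-1 A q ⟩
    ∑ (allMaps n q) (λ f → 𝟙 (noAscent A f))
      ≡⟨ ∑-cong (allMaps n q) 𝟙-noAscent ⟩
    ∑ (allMaps n q) (λ f → ∑ (allMaps c q) (λ g → 𝟙 (does (f ≟ᵛ lift g))))
      ≡⟨ ∑-swap (allMaps n q) (allMaps c q) _ ⟩
    ∑ (allMaps c q) (λ g → ∑ (allMaps n q) (λ f → 𝟙 (does (f ≟ᵛ lift g))))
      ≡⟨ ∑-cong (allMaps c q) (λ g → ∑-allMaps-indicator n q (lift g)) ⟩
    ∑ (allMaps c q) (λ _ → 1ℚ)
      ≡⟨ ∑-allMaps-1 c q ⟩
    ℕtoℚ q ^ℚ c ∎
    where open ≡-Reasoning

  eval-−1-totallyCyclic : (P : Poly) → (∀ q → 1 ℕ.≤ q → eval P (ℕtoℚ q) ≡ Bsum A q 0ℚ 1ℚ) →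
    eval P (- 1ℚ) ≡ (- 1ℚ) ^ℚ c
  eval-−1-totallyCyclic P hP =
    trans (eval-unique-from-ℕ≥ P (powP c) 1
             (λ q 1≤q → trans (hP q 1≤q) (trans (Bsum-totallyCyclic q) (sym (eval-powP c (ℕtoℚ q))))) (- 1ℚ))
          (eval-powP c (- 1ℚ))

eval-−1-sum : ∀ {n c} (es : List (Edge n)) → NumComponents es c → (P : Orientation es → Poly) →
  (∀ o q → 1 ≤ q → eval (P o) (ℕtoℚ q) ≡ Bsum (orientedArcs o) q 0ℚ 1ℚ) →
  (tc? : ∀ o → Dec (TotallyCyclic (orientedArcs o))) (os : List (Orientation es)) →
  ∑ os (λ o → eval (P o) (- 1ℚ)) ≡ ℕtoℚ (length (filter tc? os)) * (- 1ℚ) ^ℚ c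
eval-−1-sum {c = c} es nc P hP tc? [] = sym (*-zeroˡ ((- 1ℚ) ^ℚ c))
eval-−1-sum {c = c} es nc P hP tc? (o ∷ os) with tc? o
... | yes tc = begin
  eval (P o) (- 1ℚ) + ∑ os (λ o → eval (P o) (- 1ℚ))
    ≡⟨ cong₂ _+_ (TotallyCyclicCount.eval-−1-totallyCyclic es o nc tc (P o) (hP o)) (eval-−1-sum es nc P hP tc? os) ⟩
  M + K * M        ≡⟨ solve 2 (λ k m → m :+ k :* m := (k :+ con 1ℚ) :* m) refl K M ⟩
  (K + 1ℚ) * M     ≡⟨ cong (_* M) (ℕtoℚ-suc (length (filter tc? os))) ⟨
  ℕtoℚ (suc (length (filter tc? os))) * M ∎
  where
  open ≡-Reasoning
  K M : ℚ
  K = ℕtoℚ (length (filter tc? os))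
  M = (- 1ℚ) ^ℚ c
... | no ¬tc = begin
  eval (P o) (- 1ℚ) + ∑ os (λ o → eval (P o) (- 1ℚ))
    ≡⟨ cong₂ _+_ (NonTotallyCyclic.eval-−1-vanishes (orientedArcs o) (P o) (hP o) ¬tc) (eval-−1-sum es nc P hP tc? os) ⟩
  0ℚ + ℕtoℚ (length (filter tc? os)) * (- 1ℚ) ^ℚ c ≡⟨ +-identityˡ _ ⟩
  ℕtoℚ (length (filter tc? os)) * (- 1ℚ) ^ℚ c     ∎
  where open ≡-Reasoning

corollary7p3 :
    (n : ℕ) (es : List (Edge n)) (c : ℕ) → NumComponents es c →
    (P : Orientation es → Poly) →
    (∀ o (q : ℕ) → 1 ≤ q →
       eval (P o) (ℕtoℚ q) ≡ Bsum (orientedArcs o) q ((two - two) ÷ two) 1ℚ) →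
    (tc? : ∀ o → Dec (TotallyCyclic (orientedArcs o))) →
    let x = 0ℚ
        y = two
        m = length es
    in ℕtoℚ (length (filter tc? (allOrientations es)))
         * ((two ^ℚ m) * ((y - 1ℚ) ^ℚ n) * ((x - 1ℚ) ^ℚ c))
       ≡ (y ^ℚ m) * sumℚ (map (λ o → eval (P o) ((x - 1ℚ) * (y - 1ℚ))) (allOrientations es))
-- At (x, y) = (0, 2) the terms (2 − y)/y, y − 1 and (x − 1)(y − 1) compute to 0, 1 and −1.
corollary7p3 n es c nc P hP tc? = begin
  K * (2^m * (1ℚ ^ℚ n) * M)   ≡⟨ cong (λ u → K * (2^m * u * M)) (1^ℚ n) ⟩
  K * (2^m * 1ℚ * M)          ≡⟨ solve 3 (λ k t m → k :* (t :* con 1ℚ :* m) := t :* (k :* m)) refl K 2^m M ⟩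
  2^m * (K * M)               ≡⟨ cong (2^m *_) (eval-−1-sum es nc P hP tc? (allOrientations es)) ⟨
  2^m * ∑ (allOrientations es) (λ o → eval (P o) (- 1ℚ)) ∎
  where
  open ≡-Reasoning
  K 2^m M : ℚ
  K   = ℕtoℚ (length (filter tc? (allOrientations es)))
  2^m = two ^ℚ length es
  M   = (- 1ℚ) ^ℚ c
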